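{- Let $n\geq4$ and $\kappa=\gamma_0+\gamma_2+\gamma_4$ on $\mathbb{F}_2^n$. Then $\kappa$ is a permutation of $\mathbb{F}_2^n$ if and only if $n$ is not a multiple of $6$. In that case $\kappa^{ -1}=\sum_i b_i\gamma_{2i}$, where $B(X)=\sum_i b_iX^i$ is given as follows: if $n$ is odd, with $k$ the least integer such that $3k\geq(n+1)/2$, $B=P_{3k}$ when $n\equiv3,5\pmod6$ and $B=P_{3k}-X^{3k-2}$ when $n\equiv1\pmod 6$; if $n=6k+2$, $B=1+XP_{3k}+X^2P_{6k}$; if $n=6k+4$, $B=1+X^2P_{3k}+XP_{6k+3}$ (so $[B]$ is the inverse of $[1+X+X^2]$ in $\mathbb{F}_2[X]/(X^{(n+1)/2})$ for odd $n$, resp. in $\mathbb{F}_2[X]/(X^n+X^{n/2})$ for even $n$). The algebraic degree of $\kappa$ is $3$, and (for $n$ not a multiple of $6$) the algebraic degree $d$ of $\kappa^{ -1}$ is $$d=\begin{cases} n/2+1 & \text{if } n\equiv0,2,4\pmod 6,\\ (n+1)/2 & \text{if } n\equiv1,3\pmod6,\\ (n-1)/2 & \text{if } n\equiv5\pmod 6.\end{cases}$$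
   Context: Let $\mathbbm{1}=(1,\dots,1)\in\mathbb{F}_2^n$, let $\odot$ denote component-wise multiplication in $\mathbb{F}_2^n$, and let $S(x_1,\dots,x_n)=(x_2,\dots,x_n,x_1)$. Define $\gamma_0=\mathrm{id}$ and, for $k\geq1$, $\gamma_{2k}(x)=S^{2k}(x)\odot(\mathbbm{1}+S^{2k-1}(x))\odot(\mathbbm{1}+S^{2k-3}(x))\odot\cdots\odot(\mathbbm{1}+S(x))$ on $\mathbb{F}_2^n$; sums of functions are pointwise. $P_0=0$ and for $j\geq1$, $P_{3j}(X)=\frac{1+X^{3j}}{1+X+X^2}=(1+X)(1+X^3+\cdots+X^{3(j-1)})\in\mathbb{F}_2[X]$. The algebraic degree of $g:\mathbb{F}_2^n\to\mathbb{F}_2^n$ is the maximal degree of the reduced multivariate polynomial representations over $\mathbb{F}_2$ of its coordinate functions. -}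

module Defs where

open import Data.Bool using (Bool; true; false; _∧_; _xor_; if_then_else_)
open import Data.Nat using (ℕ; zero; suc; _+_; _*_; _≤_; _<_)
open import Data.Fin using (Fin)
open import Data.Fin.Subset using (Subset; ∣_∣)
open import Data.Vec using (Vec; []; _∷_; _∷ʳ_; replicate; zipWith; lookup)
open import Data.List using (List; []; _∷_; foldr; map; _++_)
import Data.List as L
open import Data.List.Relation.Unary.All using (All)
open import Data.Product using (_×_; ∃-syntax)
open import Relation.Binary.PropositionalEquality using (_≡_)
open import Relation.Nullary using (¬_)

-- F₂ = Bool (xor = addition, ∧ = multiplication); F₂^n = Vec Bool n

_⊙_ : ∀ {n} → Vec Bool n → Vec Bool n → Vec Bool n
_⊙_ = zipWith _∧_

_⊕_ : ∀ {n} → Vec Bool n → Vec Bool n → Vec Bool n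
_⊕_ = zipWith _xor_

𝟙 : ∀ {n} → Vec Bool n
𝟙 = replicate _ true

𝟘 : ∀ {n} → Vec Bool n
𝟘 = replicate _ false

S : ∀ {n} → Vec Bool n → Vec Bool n
S []       = []
S (x ∷ xs) = xs ∷ʳ x

S^ : ∀ {n} → ℕ → Vec Bool n → Vec Bool n
S^ zero    x = x
S^ (suc m) x = S (S^ m x)

γprod : ∀ {n} → ℕ → Vec Bool n → Vec Bool n
γprod zero    x = 𝟙
γprod (suc j) x = γprod j x ⊙ (𝟙 ⊕ S^ (2 * j + 1) x)

-- γ k  is  γ_{2k}:  γ_0 = id,  γ_{2k}(x) = S^{2k}(x) ⊙ (𝟙+S^{2k-1}x) ⊙ ⋯ ⊙ (𝟙+S x)
γ : ∀ {n} → ℕ → Vec Bool n → Vec Bool n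
γ zero    x = x
γ (suc k) x = S^ (2 * suc k) x ⊙ γprod (suc k) x

κ : ∀ {n} → Vec Bool n → Vec Bool n
κ x = x ⊕ (γ 1 x ⊕ γ 2 x)

-- Polynomials in F₂[X] as coefficient lists (index i = coefficient of X^i)

Poly : Set
Poly = List Bool

coeff : Poly → ℕ → Bool
coeff []      _       = false
coeff (a ∷ p) zero    = a
coeff (a ∷ p) (suc i) = coeff p i

_+P_ : Poly → Poly → Poly
[]      +P q       = q
(a ∷ p) +P []      = a ∷ p
(a ∷ p) +P (b ∷ q) = (a xor b) ∷ (p +P q)

_*P_ : Poly → Poly → Poly
[]      *P q = []
(a ∷ p) *P q = (if a then q else []) +P (false ∷ (p *P q))

X^ : ℕ → Poly
X^ m = L.replicate m false ++ (true ∷ [])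

oneP : Poly
oneP = X^ 0

Xp : Poly
Xp = X^ 1

-- equality of polynomials (coefficientwise; trailing zeros irrelevant)
_≈P_ : Poly → Poly → Set
p ≈P q = ∀ i → coeff p i ≡ coeff q i

CongMod : Poly → Poly → Poly → Set
CongMod m a b = ∃[ q ] ((a +P b) ≈P (q *P m))

geom3 : ℕ → Poly
geom3 zero    = []
geom3 (suc j) = geom3 j +P X^ (3 * j)

-- P3 j  is  P_{3j} = (1+X)(1 + X^3 + ⋯ + X^{3(j-1)})   (P_0 = 0)
P3 : ℕ → Poly
P3 j = (oneP +P Xp) *P geom3 j

applyPolyFrom : ∀ {n} → ℕ → Poly → Vec Bool n → Vec Bool n
applyPolyFrom i []      x = 𝟘
applyPolyFrom i (b ∷ B) x = (if b then γ i x else 𝟘) ⊕ applyPolyFrom (suc i) B x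

applyPoly : ∀ {n} → Poly → Vec Bool n → Vec Bool n
applyPoly B x = applyPolyFrom 0 B x

-- Algebraic degree.
-- A multilinear polynomial over F₂ in x₁…xₙ is a list of monomials,
-- each monomial given by its set of variables (Subset n).

monoEval : ∀ {n} → Subset n → Vec Bool n → Bool
monoEval []       []       = true
monoEval (u ∷ us) (x ∷ xs) = (if u then x else true) ∧ monoEval us xs

polyEval : ∀ {n} → List (Subset n) → Vec Bool n → Bool
polyEval p x = foldr _xor_ false (map (λ u → monoEval u x) p)

DegLe : ∀ {n} → (Vec Bool n → Vec Bool n) → ℕ → Set
DegLe {n} g d = ∀ (i : Fin n) → ∃[ p ] (All (λ u → ∣ u ∣ ≤ d) p × (∀ x → polyEval p x ≡ lookup (g x) i))

HasAlgDeg : ∀ {n} → (Vec Bool n → Vec Bool n) → ℕ → Set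
HasAlgDeg g d = DegLe g d × (∀ e → e < d → ¬ DegLe g e)

open import Data.Nat using (_/_; _%_; _∸_)

oneXX : Poly
oneXX = oneP +P (Xp +P X^ 2)

InvOfκ : (n : ℕ) → Poly → Set
InvOfκ n B = ∀ (x : Vec Bool n) → (applyPoly B (κ x) ≡ x) × (κ (applyPoly B x) ≡ x)

dvalR : ℕ → ℕ → ℕ
dvalR n 1 = (n + 1) / 2
dvalR n 3 = (n + 1) / 2
dvalR n 5 = (n ∸ 1) / 2
dvalR n _ = n / 2 + 1

dval : ℕ → ℕ
dval n = dvalR n (n % 6)

-- Read x ∈ F₂ⁿ as the n-periodic sequence k ↦ x_{k mod n} and write F_B = Σ_i b_i γ_{2i}. The key
-- identity γ_{2a} ∘ F_B = F_{X^a B} for b₀ = 1 gives F_A ∘ F_B = F_{AB}, and κ = F_{1+X+X²}. On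
-- n-periodic sequences F_M = 0 for M = X^{(n+1)/2} when n is odd (γ_{2j} vanishes once 2j > n) and for
-- M = X^n + X^{n/2} when n is even (γ_{2(j+n/2)} = γ_{2j} once 2j ≥ n), so any B with b₀ = 1 inverting
-- 1 + X + X² modulo M gives κ⁻¹ = F_B; the given B are checked with (1 + X + X²) P_{3j} = 1 + X^{3j}.
-- When 6 ∣ n, κ maps the 6-periodic word 000101… to 0. Finally γ_{2j}(x)_0 = x_{2j} (1 + x_1)⋯(1 + x_{2j−1})
-- has degree j + 1, its derivative along x_{2j}, x_1, …, x_{2j−1} is 1, and that of every other γ_{2t}
-- occurring in B is 0; so the degree of F_B is read off the top coefficient of B (for even n = 2H the
-- top terms are γ_{2(H+c)}(x)_0 = x_{2c} ∏ (1 + x_odd)).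

module Submission where

open import Defs
open import Data.Bool using (Bool)
open import Data.Nat using (ℕ; _+_; _*_; _∸_; _≤_; _/_; _%_)
open import Data.Nat.Divisibility using (_∣_)
open import Data.Vec using (Vec)
open import Data.Product using (_×_)
open import Data.Sum using (_⊎_)
open import Function.Bundles using (_⇔_)
open import Function.Definitions using (Bijective)
open import Relation.Binary.PropositionalEquality using (_≡_)
open import Relation.Nullary using (¬_)

open import Algebra.Bundles using (CommutativeSemigroup; CommutativeRing)
open import Data.Bool using (true; false; not; _∧_; _∨_; _xor_; if_then_else_)
open import Data.Bool.Properties
  using (xor-same; xor-comm; xor-assoc; xor-identityʳ; ∧-comm; ∧-assoc; ∧-idem; ∧-zeroʳ; ∧-identityʳ;
         ∧-distribˡ-xor; ∧-distribʳ-xor; xor-∧-commutativeRing)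
open import Data.Fin using (Fin; toℕ; fromℕ<; inject₁) renaming (zero to fzero; suc to fsuc)
open import Data.Fin.Properties using (toℕ-injective; toℕ-fromℕ<; toℕ-inject₁; fromℕ<-toℕ; toℕ<n)
open import Data.Fin.Subset using (Subset; ∣_∣; ⊥; ⁅_⁆; _∪_)
open import Data.Fin.Subset.Properties using (∣⊥∣≡0; ∣⁅x⁆∣≡1)
open import Data.List using (List; []; _∷_; _++_; length)
import Data.List as List
open import Data.List.Properties using (++-assoc; ++-identityʳ)
open import Data.List.Membership.Propositional using (_∈_)
open import Data.List.Relation.Unary.All using (All; []; _∷_)
import Data.List.Relation.Unary.All as All
import Data.List.Relation.Unary.All.Properties as Allₚ
open import Data.List.Relation.Unary.AllPairs using ([]; _∷_)
open import Data.List.Relation.Unary.Any using (here; there)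
open import Data.List.Relation.Unary.Unique.Propositional using (Unique)
open import Data.Nat using (zero; suc; _<_; z≤n; s≤s)
open import Data.Nat.DivMod using (_mod_; m≡m%n+[m/n]*n; m%n<n; m<n⇒m%n≡m; [m+kn]%n≡m%n; m*n/n≡m)
open import Data.Nat.Divisibility using (divides)
open import Data.Nat.Properties
open import Data.Nat.Tactic.RingSolver using (solve-∀)
open import Data.Product using (_,_; proj₁; proj₂; ∃-syntax)
open import Data.Sum using (inj₁; inj₂)
open import Data.Vec using ([]; _∷_; _∷ʳ_; lookup; replicate; zipWith; toList; tabulate; updateAt; _[_]≔_)
open import Data.Vec.Properties
  using (toList-∷ʳ; toList-injective; length-toList; cast-is-id; tabulate∘lookup; tabulate-cong; lookup∘tabulate;
         lookup-zipWith; lookup-replicate; zipWith-identityʳ; lookup∘updateAt; lookup∘updateAt′)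
open import Function using (_∘_)
open import Function.Bundles using (mk⇔)
open import Function.Definitions using (Injective)
open import Level using (0ℓ)
open import Relation.Binary.Bundles using (Setoid)
open import Relation.Binary.PropositionalEquality using (_≢_; refl; sym; trans; cong; cong₂; subst; module ≡-Reasoning)
import Relation.Binary.Reasoning.Setoid as SetoidReasoning
open import Relation.Nullary using (yes; no; contradiction)

open import Algebra.Properties.CommutativeSemigroup (CommutativeRing.+-commutativeSemigroup xor-∧-commutativeRing)
  using () renaming (interchange to xor-interchange)
open import Algebra.Properties.CommutativeSemigroup (CommutativeRing.*-commutativeSemigroup xor-∧-commutativeRing)
  using ()
  renaming (x∙yz≈y∙xz to x∧[y∧z]≡y∧[x∧z]; xy∙z≈zx∙y to [x∧y]∧z≡[z∧x]∧y; interchange to ∧-interchange)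

-- Vectors as periodic sequences

Seq : Set
Seq = ℕ → Bool

Periodic : ℕ → Seq → Set
Periodic n z = ∀ k → z (k + n) ≡ z k

Periodic-* : ∀ {n z} → Periodic n z → ∀ q → Periodic (q * n) z
Periodic-* {z = z} per zero    k = cong z (+-identityʳ k)
Periodic-* {n} {z} per (suc q) k = begin
  z (k + (n + q * n)) ≡⟨ cong z (+-assoc k n (q * n)) ⟨
  z (k + n + q * n)   ≡⟨ Periodic-* per q (k + n) ⟩
  z (k + n)           ≡⟨ per k ⟩
  z k                 ∎
  where open ≡-Reasoning

head₀ : ∀ {n} → Vec Bool n → Bool
head₀ []      = false
head₀ (a ∷ _) = a

-- coord x k = x_{k mod n} with indices from 0; it is false when n = 0.
coord : ∀ {n} → Vec Bool n → ℕ → Bool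
coord x k = head₀ (S^ k x)

S^-+ : ∀ {n} k m (x : Vec Bool n) → S^ k (S^ m x) ≡ S^ (k + m) x
S^-+ zero    m x = refl
S^-+ (suc k) m x = cong S (S^-+ k m x)

S^-suc : ∀ {n} k (x : Vec Bool n) → S^ (suc k) x ≡ S^ k (S x)
S^-suc zero    x = refl
S^-suc (suc k) x = cong S (S^-suc k x)

coord-S^ : ∀ {n} (x : Vec Bool n) m k → coord (S^ m x) k ≡ coord x (k + m)
coord-S^ x m k = cong head₀ (S^-+ k m x)

rotate₁ : ∀ {A : Set} → List.List A → List.List A
rotate₁ List.[]        = List.[]
rotate₁ (a List.∷ l) = l List.++ List.[ a ]

rotate : ∀ {A : Set} → ℕ → List.List A → List.List A
rotate zero    l = l
rotate (suc k) l = rotate k (rotate₁ l)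

rotate-++ : ∀ {A : Set} (ys zs : List.List A) → rotate (List.length ys) (ys List.++ zs) ≡ zs List.++ ys
rotate-++ List.[]         zs = sym (++-identityʳ zs)
rotate-++ (y List.∷ ys) zs = begin
  rotate (List.length ys) ((ys List.++ zs) List.++ List.[ y ]) ≡⟨ cong (rotate (List.length ys)) (++-assoc ys zs _) ⟩
  rotate (List.length ys) (ys List.++ (zs List.++ List.[ y ])) ≡⟨ rotate-++ ys _ ⟩
  (zs List.++ List.[ y ]) List.++ ys                           ≡⟨ ++-assoc zs _ ys ⟩
  zs List.++ (y List.∷ ys)                                     ∎
  where open ≡-Reasoning

toList-S : ∀ {n} (x : Vec Bool n) → toList (S x) ≡ rotate₁ (toList x)
toList-S []       = refl
toList-S (a ∷ xs) = toList-∷ʳ a xs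

toList-S^ : ∀ {n} k (x : Vec Bool n) → toList (S^ k x) ≡ rotate k (toList x)
toList-S^ zero    x = refl
toList-S^ (suc k) x = begin
  toList (S^ (suc k) x)        ≡⟨ cong toList (S^-suc k x) ⟩
  toList (S^ k (S x))          ≡⟨ toList-S^ k (S x) ⟩
  rotate k (toList (S x))      ≡⟨ cong (rotate k) (toList-S x) ⟩
  rotate (suc k) (toList x)    ∎
  where open ≡-Reasoning

S^-length : ∀ {n} (x : Vec Bool n) → S^ n x ≡ x
S^-length {n} x = trans (sym (cast-is-id refl (S^ n x))) (toList-injective refl (S^ n x) x (begin
  toList (S^ n x)                              ≡⟨ toList-S^ n x ⟩
  rotate n (toList x)                          ≡⟨ cong₂ rotate (sym (length-toList x)) (sym (++-identityʳ (toList x))) ⟩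
  rotate (List.length (toList x)) (toList x List.++ List.[]) ≡⟨ rotate-++ (toList x) List.[] ⟩
  toList x                                     ∎))
  where open ≡-Reasoning

coord-periodic : ∀ {n} (x : Vec Bool n) → Periodic n (coord x)
coord-periodic {n} x k = trans (sym (coord-S^ x n k)) (cong (λ v → coord v k) (S^-length x))

lookup-∷ʳ-inject₁ : ∀ {m} (xs : Vec Bool m) a (i : Fin m) → lookup (xs ∷ʳ a) (inject₁ i) ≡ lookup xs i
lookup-∷ʳ-inject₁ (x ∷ xs) a fzero    = refl
lookup-∷ʳ-inject₁ (x ∷ xs) a (fsuc i) = lookup-∷ʳ-inject₁ xs a i

coord-fromℕ< : ∀ {m} k (x : Vec Bool (suc m)) (k<n : k < suc m) → coord x k ≡ lookup x (fromℕ< k<n)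
coord-fromℕ< zero    (a ∷ xs) _ = refl
coord-fromℕ< {suc m} (suc k) (a ∷ xs) (s≤s k<n) = begin
  coord (a ∷ xs) (suc k)                                ≡⟨ cong head₀ (S^-suc k (a ∷ xs)) ⟩
  coord (xs ∷ʳ a) k                                     ≡⟨ coord-fromℕ< k (xs ∷ʳ a) (m≤n⇒m≤1+n k<n) ⟩
  lookup (xs ∷ʳ a) (fromℕ< (m≤n⇒m≤1+n k<n))            ≡⟨ cong (lookup (xs ∷ʳ a)) fromℕ<-inject₁ ⟩
  lookup (xs ∷ʳ a) (inject₁ (fromℕ< k<n))               ≡⟨ lookup-∷ʳ-inject₁ xs a (fromℕ< k<n) ⟩
  lookup xs (fromℕ< k<n)                                ∎
  where
  open ≡-Reasoning
  fromℕ<-inject₁ : fromℕ< (m≤n⇒m≤1+n k<n) ≡ inject₁ (fromℕ< k<n)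
  fromℕ<-inject₁ = toℕ-injective (trans (toℕ-fromℕ< _) (sym (trans (toℕ-inject₁ _) (toℕ-fromℕ< k<n))))

lookup-coord : ∀ {m} (x : Vec Bool (suc m)) (i : Fin (suc m)) → lookup x i ≡ coord x (toℕ i)
lookup-coord x i = trans (cong (lookup x) (sym (fromℕ<-toℕ i (toℕ<n i)))) (sym (coord-fromℕ< (toℕ i) x (toℕ<n i)))

coord-ext : ∀ {m} {x y : Vec Bool (suc m)} → (∀ k → coord x k ≡ coord y k) → x ≡ y
coord-ext {x = x} {y} h = begin
  x                  ≡⟨ tabulate∘lookup x ⟨
  tabulate (lookup x) ≡⟨ tabulate-cong (λ i → trans (lookup-coord x i) (trans (h (toℕ i)) (sym (lookup-coord y i)))) ⟩
  tabulate (lookup y) ≡⟨ tabulate∘lookup y ⟩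
  y                  ∎
  where open ≡-Reasoning

pos : ∀ {m} → ℕ → Fin (suc m)
pos {m} k = k mod suc m

coord-pos : ∀ {m} (x : Vec Bool (suc m)) k → coord x k ≡ lookup x (pos k)
coord-pos {m} x k = begin
  coord x k                                 ≡⟨ cong (coord x) (m≡m%n+[m/n]*n k (suc m)) ⟩
  coord x (k % suc m + (k / suc m) * suc m) ≡⟨ Periodic-* (coord-periodic x) (k / suc m) (k % suc m) ⟩
  coord x (k % suc m)                       ≡⟨ coord-fromℕ< (k % suc m) x (m%n<n k (suc m)) ⟩
  lookup x (pos k)                          ∎
  where open ≡-Reasoning

coord-zipWith : ∀ {m} f (x y : Vec Bool (suc m)) k → coord (zipWith f x y) k ≡ f (coord x k) (coord y k)
coord-zipWith f x y k = trans (coord-pos (zipWith f x y) k)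
  (trans (lookup-zipWith f (pos k) x y) (sym (cong₂ f (coord-pos x k) (coord-pos y k))))

coord-replicate : ∀ {m} (a : Bool) k → coord (replicate (suc m) a) k ≡ a
coord-replicate a k = trans (coord-pos (replicate _ a) k) (lookup-replicate (pos k) a)

-- Polynomials over F₂

infix 4 _≋_
record _≋_ (p q : Poly) : Set where
  constructor mk≋
  field coeffwise : p ≈P q
open _≋_ public

≋-refl : ∀ {p} → p ≋ p
≋-refl = mk≋ (λ i → refl)

≋-sym : ∀ {p q} → p ≋ q → q ≋ p
≋-sym p≋q = mk≋ (λ i → sym (coeffwise p≋q i))

≋-trans : ∀ {p q r} → p ≋ q → q ≋ r → p ≋ r
≋-trans p≋q q≋r = mk≋ (λ i → trans (coeffwise p≋q i) (coeffwise q≋r i))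

≋-reflexive : ∀ {p q} → p ≡ q → p ≋ q
≋-reflexive refl = ≋-refl

≋-setoid : Setoid 0ℓ 0ℓ
≋-setoid = record
  { Carrier = Poly ; _≈_ = _≋_
  ; isEquivalence = record { refl = ≋-refl ; sym = ≋-sym ; trans = ≋-trans } }

∷-cong : ∀ {a b p q} → a ≡ b → p ≋ q → (a ∷ p) ≋ (b ∷ q)
∷-cong a≡b p≋q = mk≋ (λ { zero → a≡b ; (suc i) → coeffwise p≋q i })

coeff-+P : ∀ p q i → coeff (p +P q) i ≡ coeff p i xor coeff q i
coeff-+P []      q       i       = refl
coeff-+P (a ∷ p) []      i       = sym (xor-identityʳ _)
coeff-+P (a ∷ p) (b ∷ q) zero    = refl
coeff-+P (a ∷ p) (b ∷ q) (suc i) = coeff-+P p q i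

+P-cong : ∀ {p p' q q'} → p ≋ p' → q ≋ q' → (p +P q) ≋ (p' +P q')
+P-cong {p} {p'} {q} {q'} p≋p' q≋q' = mk≋ λ i → begin
  coeff (p +P q) i              ≡⟨ coeff-+P p q i ⟩
  coeff p i xor coeff q i       ≡⟨ cong₂ _xor_ (coeffwise p≋p' i) (coeffwise q≋q' i) ⟩
  coeff p' i xor coeff q' i     ≡⟨ coeff-+P p' q' i ⟨
  coeff (p' +P q') i            ∎
  where open ≡-Reasoning

+P-congˡ : ∀ p {q q'} → q ≋ q' → (p +P q) ≋ (p +P q')
+P-congˡ p = +P-cong (≋-refl {p})

+P-congʳ : ∀ r {p p'} → p ≋ p' → (p +P r) ≋ (p' +P r)
+P-congʳ r p≋p' = +P-cong p≋p' (≋-refl {r})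

+P-comm : ∀ p q → (p +P q) ≋ (q +P p)
+P-comm p q = mk≋ λ i → trans (coeff-+P p q i) (trans (xor-comm (coeff p i) _) (sym (coeff-+P q p i)))

+P-assoc : ∀ p q r → ((p +P q) +P r) ≋ (p +P (q +P r))
+P-assoc p q r = mk≋ λ i → begin
  coeff ((p +P q) +P r) i                   ≡⟨ trans (coeff-+P (p +P q) r i) (cong (_xor coeff r i) (coeff-+P p q i)) ⟩
  (coeff p i xor coeff q i) xor coeff r i   ≡⟨ xor-assoc (coeff p i) _ _ ⟩
  coeff p i xor (coeff q i xor coeff r i)   ≡⟨ trans (coeff-+P p (q +P r) i) (cong (coeff p i xor_) (coeff-+P q r i)) ⟨
  coeff (p +P (q +P r)) i                   ∎
  where open ≡-Reasoning

+P-identityʳ : ∀ p → (p +P []) ≋ p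
+P-identityʳ p = mk≋ λ i → trans (coeff-+P p [] i) (xor-identityʳ _)

+P-self : ∀ p → (p +P p) ≋ []
+P-self p = mk≋ λ i → trans (coeff-+P p p i) (xor-same (coeff p i))

+P-commutativeSemigroup : CommutativeSemigroup 0ℓ 0ℓ
+P-commutativeSemigroup = record
  { Carrier = Poly ; _≈_ = _≋_ ; _∙_ = _+P_
  ; isCommutativeSemigroup = record
    { isSemigroup = record
      { isMagma = record { isEquivalence = Setoid.isEquivalence ≋-setoid ; ∙-cong = +P-cong }
      ; assoc = +P-assoc }
    ; comm = +P-comm } }

open import Algebra.Properties.CommutativeSemigroup +P-commutativeSemigroup
  using () renaming (interchange to +P-interchange; x∙yz≈y∙xz to +P-swapˡ; xy∙z≈xz∙y to +P-swapʳ)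

+P-cancelˡ : ∀ p q → (p +P (p +P q)) ≋ q
+P-cancelˡ p q = ≋-trans (≋-sym (+P-assoc p p q)) (+P-cong (+P-self p) ≋-refl)

if-+P : ∀ a b r → (if a xor b then r else []) ≋ ((if a then r else []) +P (if b then r else []))
if-+P false b     r = ≋-refl
if-+P true  false r = ≋-sym (+P-identityʳ r)
if-+P true  true  r = ≋-sym (+P-self r)

*P-zeroʳ : ∀ p → (p *P []) ≋ []
*P-zeroʳ []          = ≋-refl
*P-zeroʳ (false ∷ p) = mk≋ λ { zero → refl ; (suc i) → coeffwise (*P-zeroʳ p) i }
*P-zeroʳ (true ∷ p)  = mk≋ λ { zero → refl ; (suc i) → coeffwise (*P-zeroʳ p) i }

*P-congʳ : ∀ p {q q'} → q ≋ q' → (p *P q) ≋ (p *P q')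
*P-congʳ []          q≋q' = ≋-refl
*P-congʳ (false ∷ p) q≋q' = ∷-cong refl (*P-congʳ p q≋q')
*P-congʳ (true ∷ p)  q≋q' = +P-cong q≋q' (∷-cong refl (*P-congʳ p q≋q'))

*P-distribʳ : ∀ p q r → ((p +P q) *P r) ≋ ((p *P r) +P (q *P r))
*P-distribʳ []      q       r = ≋-refl
*P-distribʳ (a ∷ p) []      r = ≋-sym (+P-identityʳ _)
*P-distribʳ (a ∷ p) (b ∷ q) r = ≋-trans (+P-cong (if-+P a b r) (∷-cong refl (*P-distribʳ p q r)))
  (+P-interchange (if a then r else []) (if b then r else []) (false ∷ (p *P r)) (false ∷ (q *P r)))

*P-distribˡ : ∀ r p q → (r *P (p +P q)) ≋ ((r *P p) +P (r *P q))
*P-distribˡ []          p q = ≋-refl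
*P-distribˡ (false ∷ r) p q = ∷-cong refl (*P-distribˡ r p q)
*P-distribˡ (true ∷ r)  p q = ≋-trans (+P-cong ≋-refl (∷-cong refl (*P-distribˡ r p q)))
  (+P-interchange p q (false ∷ (r *P p)) (false ∷ (r *P q)))

*P-assoc : ∀ p q r → ((p *P q) *P r) ≋ (p *P (q *P r))
*P-assoc []          q r = ≋-refl
*P-assoc (false ∷ p) q r = ∷-cong refl (*P-assoc p q r)
*P-assoc (true ∷ p)  q r = ≋-trans (*P-distribʳ q (false ∷ (p *P q)) r) (+P-cong ≋-refl (∷-cong refl (*P-assoc p q r)))

*P-identityˡ : ∀ p → (oneP *P p) ≋ p
*P-identityˡ p = mk≋ λ i → trans (coeff-+P p (false ∷ []) i) (trans (cong (coeff p i xor_) (zero-coeff i)) (xor-identityʳ _))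
  where
  zero-coeff : ∀ i → coeff (false ∷ []) i ≡ false
  zero-coeff zero    = refl
  zero-coeff (suc i) = refl

*P-comm : ∀ p q → (p *P q) ≋ (q *P p)
*P-comm []      q       = ≋-sym (*P-zeroʳ q)
*P-comm (a ∷ p) []      = *P-zeroʳ (a ∷ p)
*P-comm (a ∷ p) (b ∷ q) = begin
  (a ∷ p) *P (b ∷ q)
    ≈⟨ +P-congʳ (false ∷ (p *P (b ∷ q))) (if-∷ a b q) ⟩
  ((a ∧ b) xor false) ∷ (aq +P (p *P (b ∷ q)))
    ≈⟨ ∷-cong (cong (_xor false) (∧-comm a b)) (+P-congˡ aq (*P-comm p (b ∷ q))) ⟩
  ((b ∧ a) xor false) ∷ (aq +P (bp +P (false ∷ (q *P p))))
    ≈⟨ ∷-cong refl (+P-swapˡ aq bp (false ∷ (q *P p))) ⟩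
  ((b ∧ a) xor false) ∷ (bp +P (aq +P (false ∷ (q *P p))))
    ≈⟨ ∷-cong refl (+P-congˡ bp (+P-congˡ aq (∷-cong refl (*P-comm q p)))) ⟩
  ((b ∧ a) xor false) ∷ (bp +P ((a ∷ p) *P q))
    ≈⟨ ∷-cong refl (+P-congˡ bp (*P-comm q (a ∷ p))) ⟨
  ((b ∧ a) xor false) ∷ (bp +P (q *P (a ∷ p)))
    ≈⟨ +P-congʳ (false ∷ (q *P (a ∷ p))) (if-∷ b a p) ⟨
  (b ∷ q) *P (a ∷ p) ∎
  where
  open SetoidReasoning ≋-setoid
  aq = if a then q else []
  bp = if b then p else []
  if-∷ : ∀ a b q → (if a then (b ∷ q) else []) ≋ ((a ∧ b) ∷ (if a then q else []))
  if-∷ false b q = mk≋ λ { zero → refl ; (suc i) → refl }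
  if-∷ true  b q = ≋-refl

*P-congˡ : ∀ {p p'} r → p ≋ p' → (p *P r) ≋ (p' *P r)
*P-congˡ {p} {p'} r p≋p' = ≋-trans (*P-comm p r) (≋-trans (*P-congʳ r p≋p') (*P-comm r p'))

X^-*P-X^ : ∀ a b → (X^ a *P X^ b) ≋ X^ (a + b)
X^-*P-X^ zero    b = *P-identityˡ (X^ b)
X^-*P-X^ (suc a) b = ∷-cong refl (X^-*P-X^ a b)

[1+X]*X^ : ∀ a → ((oneP +P Xp) *P X^ a) ≋ (X^ a +P X^ (suc a))
[1+X]*X^ a = +P-cong ≋-refl (∷-cong refl (*P-identityˡ (X^ a)))

oneXX*X^ : ∀ a → (oneXX *P X^ a) ≋ (X^ a +P (X^ (suc a) +P X^ (suc (suc a))))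
oneXX*X^ a = +P-cong ≋-refl (∷-cong refl ([1+X]*X^ a))

[1+X³]*geom3 : ∀ j → ((oneP +P X^ 3) *P geom3 j) ≋ (oneP +P X^ (3 * j))
[1+X³]*geom3 zero    = ≋-trans (*P-zeroʳ (oneP +P X^ 3)) (≋-sym (+P-self oneP))
[1+X³]*geom3 (suc j) = begin
  (oneP +P X^ 3) *P (geom3 j +P X^ (3 * j))
    ≈⟨ *P-distribˡ (oneP +P X^ 3) (geom3 j) _ ⟩
  ((oneP +P X^ 3) *P geom3 j) +P ((oneP +P X^ 3) *P X^ (3 * j))
    ≈⟨ +P-cong ([1+X³]*geom3 j) (*P-distribʳ oneP (X^ 3) _) ⟩
  (oneP +P X^ (3 * j)) +P ((oneP *P X^ (3 * j)) +P (X^ 3 *P X^ (3 * j)))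
    ≈⟨ +P-congˡ (oneP +P X^ (3 * j)) (+P-cong (*P-identityˡ _) (X^-*P-X^ 3 (3 * j))) ⟩
  (oneP +P X^ (3 * j)) +P (X^ (3 * j) +P X^ (3 + 3 * j))
    ≈⟨ +P-assoc oneP (X^ (3 * j)) (X^ (3 * j) +P X^ (3 + 3 * j)) ⟩
  oneP +P (X^ (3 * j) +P (X^ (3 * j) +P X^ (3 + 3 * j)))
    ≈⟨ +P-congˡ oneP (+P-cancelˡ (X^ (3 * j)) (X^ (3 + 3 * j))) ⟩
  oneP +P X^ (3 + 3 * j)
    ≡⟨ cong (λ e → oneP +P X^ e) (*-suc 3 j) ⟨
  oneP +P X^ (3 * suc j) ∎
  where open SetoidReasoning ≋-setoid

oneXX*P3 : ∀ j → (oneXX *P P3 j) ≋ (oneP +P X^ (3 * j))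
oneXX*P3 j = ≋-trans (≋-sym (*P-assoc oneXX (oneP +P Xp) (geom3 j))) ([1+X³]*geom3 j)

P3-suc : ∀ j → P3 (suc j) ≋ (P3 j +P (X^ (3 * j) +P X^ (suc (3 * j))))
P3-suc j = ≋-trans (*P-distribˡ (oneP +P Xp) (geom3 j) (X^ (3 * j))) (+P-congˡ (P3 j) ([1+X]*X^ (3 * j)))

oneXX*X^*P3 : ∀ a j → (oneXX *P (X^ a *P P3 j)) ≋ (X^ a +P X^ (a + 3 * j))
oneXX*X^*P3 a j = begin
  oneXX *P (X^ a *P P3 j)
    ≈⟨ *P-assoc oneXX (X^ a) (P3 j) ⟨
  (oneXX *P X^ a) *P P3 j
    ≈⟨ *P-congˡ (P3 j) (*P-comm oneXX (X^ a)) ⟩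
  (X^ a *P oneXX) *P P3 j
    ≈⟨ *P-assoc (X^ a) oneXX (P3 j) ⟩
  X^ a *P (oneXX *P P3 j)
    ≈⟨ *P-congʳ (X^ a) (oneXX*P3 j) ⟩
  X^ a *P (oneP +P X^ (3 * j))
    ≈⟨ *P-distribˡ (X^ a) oneP (X^ (3 * j)) ⟩
  (X^ a *P oneP) +P (X^ a *P X^ (3 * j))
    ≈⟨ +P-cong (≋-trans (X^-*P-X^ a 0) (≋-reflexive (cong X^ (+-identityʳ a)))) (X^-*P-X^ a (3 * j)) ⟩
  X^ a +P X^ (a + 3 * j) ∎
  where open SetoidReasoning ≋-setoid

[oneXX*P3+1]≋X^ : ∀ k → ((oneXX *P P3 k) +P oneP) ≋ X^ (3 * k)
[oneXX*P3+1]≋X^ k = ≋-trans (+P-cong (oneXX*P3 k) ≋-refl) (≋-trans (+P-comm (oneP +P X^ (3 * k)) oneP) (+P-cancelˡ oneP _))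

oneXX*P3-congruence : ∀ k h → h ≤ 3 * k → CongMod (X^ h) (oneXX *P P3 k) oneP
oneXX*P3-congruence k h h≤3k = X^ (3 * k ∸ h) , coeffwise (begin
  (oneXX *P P3 k) +P oneP ≈⟨ [oneXX*P3+1]≋X^ k ⟩
  X^ (3 * k)              ≡⟨ cong X^ (m∸n+n≡m h≤3k) ⟨
  X^ (3 * k ∸ h + h)      ≈⟨ X^-*P-X^ (3 * k ∸ h) h ⟨
  X^ (3 * k ∸ h) *P X^ h  ∎)
  where open SetoidReasoning ≋-setoid

oneXX*[P3+X^]-congruence : ∀ k e → 2 + e ≡ 3 * k → CongMod (X^ e) (oneXX *P (P3 k +P X^ e)) oneP
oneXX*[P3+X^]-congruence k e 2+e≡3k = oneP +P Xp , coeffwise (begin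
  (oneXX *P (P3 k +P X^ e)) +P oneP
    ≈⟨ +P-cong (*P-distribˡ oneXX (P3 k) (X^ e)) ≋-refl ⟩
  ((oneXX *P P3 k) +P (oneXX *P X^ e)) +P oneP
    ≈⟨ +P-assoc (oneXX *P P3 k) _ oneP ⟩
  (oneXX *P P3 k) +P ((oneXX *P X^ e) +P oneP)
    ≈⟨ +P-congˡ (oneXX *P P3 k) (+P-comm _ oneP) ⟩
  (oneXX *P P3 k) +P (oneP +P (oneXX *P X^ e))
    ≈⟨ +P-assoc (oneXX *P P3 k) oneP _ ⟨
  ((oneXX *P P3 k) +P oneP) +P (oneXX *P X^ e)
    ≈⟨ +P-cong ([oneXX*P3+1]≋X^ k) (oneXX*X^ e) ⟩
  X^ (3 * k) +P (X^ e +P (X^ (1 + e) +P X^ (2 + e)))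
    ≡⟨ cong (λ t → X^ t +P (X^ e +P (X^ (1 + e) +P X^ (2 + e)))) 2+e≡3k ⟨
  X^ (2 + e) +P (X^ e +P (X^ (1 + e) +P X^ (2 + e)))
    ≈⟨ +P-swapˡ (X^ (2 + e)) (X^ e) (X^ (1 + e) +P X^ (2 + e)) ⟩
  X^ e +P (X^ (2 + e) +P (X^ (1 + e) +P X^ (2 + e)))
    ≈⟨ +P-congˡ (X^ e) (+P-congˡ (X^ (2 + e)) (+P-comm (X^ (1 + e)) (X^ (2 + e)))) ⟩
  X^ e +P (X^ (2 + e) +P (X^ (2 + e) +P X^ (1 + e)))
    ≈⟨ +P-congˡ (X^ e) (+P-cancelˡ (X^ (2 + e)) (X^ (1 + e))) ⟩
  X^ e +P X^ (1 + e)
    ≈⟨ [1+X]*X^ e ⟨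
  (oneP +P Xp) *P X^ e ∎)
  where open SetoidReasoning ≋-setoid

-- (1 + X + X²) + 1 computes to X + X², which the hypothesis turns into X^a + X^b.
oneXX*[1+X^P3+X^P3] : ∀ a b i j → (X^ a +P X^ b) ≋ (Xp +P X^ 2) →
  ((oneXX *P (oneP +P ((X^ a *P P3 i) +P (X^ b *P P3 j)))) +P oneP) ≋ (X^ (a + 3 * i) +P X^ (b + 3 * j))
oneXX*[1+X^P3+X^P3] a b i j Xᵃ+Xᵇ≋X+X² = begin
  (oneXX *P (oneP +P (A +P B))) +P oneP
    ≈⟨ +P-cong (*P-distribˡ oneXX oneP (A +P B)) ≋-refl ⟩
  ((oneXX *P oneP) +P (oneXX *P (A +P B))) +P oneP
    ≈⟨ +P-cong (+P-cong (*P-comm oneXX oneP) (*P-distribˡ oneXX A B)) ≋-refl ⟩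
  (oneXX +P ((oneXX *P A) +P (oneXX *P B))) +P oneP
    ≈⟨ +P-cong (+P-cong (*P-identityˡ oneXX) (+P-cong (oneXX*X^*P3 a i) (oneXX*X^*P3 b j))) ≋-refl ⟩
  (oneXX +P ((X^ a +P X^ (a + 3 * i)) +P (X^ b +P X^ (b + 3 * j)))) +P oneP
    ≈⟨ +P-swapʳ oneXX ((X^ a +P X^ (a + 3 * i)) +P (X^ b +P X^ (b + 3 * j))) oneP ⟩
  (Xp +P X^ 2) +P ((X^ a +P X^ (a + 3 * i)) +P (X^ b +P X^ (b + 3 * j)))
    ≈⟨ +P-congˡ (Xp +P X^ 2) (+P-interchange (X^ a) (X^ (a + 3 * i)) (X^ b) (X^ (b + 3 * j))) ⟩
  (Xp +P X^ 2) +P ((X^ a +P X^ b) +P (X^ (a + 3 * i) +P X^ (b + 3 * j)))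
    ≈⟨ +P-congˡ (Xp +P X^ 2) (+P-congʳ (X^ (a + 3 * i) +P X^ (b + 3 * j)) Xᵃ+Xᵇ≋X+X²) ⟩
  (Xp +P X^ 2) +P ((Xp +P X^ 2) +P (X^ (a + 3 * i) +P X^ (b + 3 * j)))
    ≈⟨ +P-cancelˡ (Xp +P X^ 2) _ ⟩
  X^ (a + 3 * i) +P X^ (b + 3 * j) ∎
  where
  open SetoidReasoning ≋-setoid
  A = X^ a *P P3 i
  B = X^ b *P P3 j

record DegBelow (p : Poly) (L : ℕ) : Set where
  constructor degBelow
  field vanishes-from : ∀ j → L ≤ j → coeff p j ≡ false
open DegBelow public

HasDegree : Poly → ℕ → Set
HasDegree p J = coeff p J ≡ true × DegBelow p (suc J)

DegBelow⇒< : ∀ {p L j} → DegBelow p L → coeff p j ≡ true → j < L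
DegBelow⇒< {L = L} {j} below pⱼ with j <? L
... | yes j<L = j<L
... | no  j≮L with () ← trans (sym pⱼ) (vanishes-from below j (≮⇒≥ j≮L))

DegBelow-mono : ∀ {p L L'} → L ≤ L' → DegBelow p L → DegBelow p L'
DegBelow-mono L≤L' below = degBelow λ j L'≤j → vanishes-from below j (≤-trans L≤L' L'≤j)

DegBelow-≋ : ∀ {p q L} → p ≋ q → DegBelow p L → DegBelow q L
DegBelow-≋ p≋q below = degBelow λ j L≤j → trans (sym (coeffwise p≋q j)) (vanishes-from below j L≤j)

DegBelow-+P : ∀ {p q L} → DegBelow p L → DegBelow q L → DegBelow (p +P q) L
DegBelow-+P {p} {q} p-below q-below = degBelow λ j L≤j →
  trans (coeff-+P p q j) (cong₂ _xor_ (vanishes-from p-below j L≤j) (vanishes-from q-below j L≤j))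

coeff-X^-same : ∀ a → coeff (X^ a) a ≡ true
coeff-X^-same zero    = refl
coeff-X^-same (suc a) = coeff-X^-same a

coeff-X^-other : ∀ {a j} → a ≢ j → coeff (X^ a) j ≡ false
coeff-X^-other {zero}  {zero}  a≢j = contradiction refl a≢j
coeff-X^-other {zero}  {suc j} a≢j = refl
coeff-X^-other {suc a} {zero}  a≢j = refl
coeff-X^-other {suc a} {suc j} a≢j = coeff-X^-other (a≢j ∘ cong suc)

DegBelow-X^ : ∀ a → DegBelow (X^ a) (suc a)
DegBelow-X^ a = degBelow λ j a<j → coeff-X^-other (<⇒≢ a<j)

coeff-X^*P : ∀ a p j → coeff (X^ a *P p) (a + j) ≡ coeff p j
coeff-X^*P zero    p j = coeffwise (*P-identityˡ p) j
coeff-X^*P (suc a) p j = coeff-X^*P a p j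

DegBelow-X^*P : ∀ a {p L} → DegBelow p L → DegBelow (X^ a *P p) (a + L)
DegBelow-X^*P a {p} {L} below = degBelow (shifted a)
  where
  shifted : ∀ a j → a + L ≤ j → coeff (X^ a *P p) j ≡ false
  shifted zero    j       L≤j           = trans (coeffwise (*P-identityˡ p) j) (vanishes-from below j L≤j)
  shifted (suc a) (suc j) (s≤s a+L≤j)   = shifted a j a+L≤j

coeff-P3-suc : ∀ j i → coeff (P3 (suc j)) i ≡ coeff (P3 j) i xor (coeff (X^ (3 * j)) i xor coeff (X^ (suc (3 * j))) i)
coeff-P3-suc j i = trans (coeffwise (P3-suc j) i)
  (trans (coeff-+P (P3 j) _ i) (cong (coeff (P3 j) i xor_) (coeff-+P (X^ (3 * j)) _ i)))

P3-degBelow : ∀ j → DegBelow (P3 j) (3 * j)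
P3-top : ∀ j → HasDegree (P3 (suc j)) (suc (3 * j))

P3-degBelow zero    = DegBelow-≋ (≋-sym (*P-zeroʳ (oneP +P Xp))) (degBelow λ _ _ → refl)
P3-degBelow (suc j) = DegBelow-mono (subst (2 + 3 * j ≤_) (sym (*-suc 3 j)) (n≤1+n _)) (proj₂ (P3-top j))

P3-top j = top , below
  where
  top : coeff (P3 (suc j)) (suc (3 * j)) ≡ true
  top = trans (coeff-P3-suc j _)
    (cong₂ _xor_ (vanishes-from (P3-degBelow j) _ (n≤1+n _))
                 (cong₂ _xor_ (coeff-X^-other (<⇒≢ (n<1+n (3 * j)))) (coeff-X^-same (suc (3 * j)))))
  below : DegBelow (P3 (suc j)) (suc (suc (3 * j)))
  below = DegBelow-≋ (≋-sym (P3-suc j))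
    (DegBelow-+P (DegBelow-mono (≤-trans (n≤1+n _) (n≤1+n _)) (P3-degBelow j))
      (DegBelow-+P (DegBelow-mono (n≤1+n _) (DegBelow-X^ (3 * j))) (DegBelow-X^ (suc (3 * j)))))

P3-const : ∀ j → coeff (P3 (suc j)) 0 ≡ true
P3-const zero    = refl
P3-const (suc j) = trans (coeff-P3-suc (suc j) 0) (cong (_xor false) (P3-const j))

-- The operators γ_{2j} on sequences

oddZeros : Seq → ℕ → ℕ → Bool
oddZeros z k zero    = true
oddZeros z k (suc j) = oddZeros z k j ∧ not (z (k + (2 * j + 1)))

-- γˢ j is γ_{2j}
γˢ : ℕ → Seq → Seq
γˢ zero    z k = z k
γˢ (suc j) z k = z (k + 2 * suc j) ∧ oddZeros z k (suc j)

combFrom : ℕ → Poly → (ℕ → Bool) → Bool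
combFrom i []      φ = false
combFrom i (b ∷ B) φ = (b ∧ φ i) xor combFrom (suc i) B φ

applyPolyFromˢ : ℕ → Poly → Seq → Seq
applyPolyFromˢ i B z k = combFrom i B (λ t → γˢ t z k)

applyPolyˢ : Poly → Seq → Seq
applyPolyˢ = applyPolyFromˢ 0

γˢ-form : ∀ j z k → γˢ j z k ≡ z (k + 2 * j) ∧ oddZeros z k j
γˢ-form zero    z k = sym (trans (∧-identityʳ _) (cong z (+-identityʳ k)))
γˢ-form (suc j) z k = refl

oddZeros-suc : ∀ z k j → oddZeros z k (suc j) ≡ not (z (k + 1)) ∧ oddZeros z (k + 2) j
oddZeros-suc z k zero    = sym (∧-identityʳ _)
oddZeros-suc z k (suc j) = begin
  oddZeros z k (suc j) ∧ not (z (k + (2 * suc j + 1)))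
    ≡⟨ cong (_∧ not (z (k + (2 * suc j + 1)))) (oddZeros-suc z k j) ⟩
  (not (z (k + 1)) ∧ oddZeros z (k + 2) j) ∧ not (z (k + (2 * suc j + 1)))
    ≡⟨ ∧-assoc (not (z (k + 1))) (oddZeros z (k + 2) j) (not (z (k + (2 * suc j + 1)))) ⟩
  not (z (k + 1)) ∧ (oddZeros z (k + 2) j ∧ not (z (k + (2 * suc j + 1))))
    ≡⟨ cong (λ m → not (z (k + 1)) ∧ (oddZeros z (k + 2) j ∧ not (z m))) (shift k j) ⟩
  not (z (k + 1)) ∧ oddZeros z (k + 2) (suc j) ∎
  where
  open ≡-Reasoning
  shift : ∀ k j → k + (2 * suc j + 1) ≡ k + 2 + (2 * j + 1)
  shift = solve-∀

γˢ-suc : ∀ j z k → γˢ (suc j) z k ≡ not (z (k + 1)) ∧ γˢ j z (k + 2)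
γˢ-suc zero    z k = ∧-comm (z (k + 2)) _
γˢ-suc (suc j) z k = begin
  z (k + 2 * suc (suc j)) ∧ oddZeros z k (suc (suc j))
    ≡⟨ cong₂ _∧_ (cong z (shift k j)) (oddZeros-suc z k (suc j)) ⟩
  z (k + 2 + 2 * suc j) ∧ (not (z (k + 1)) ∧ oddZeros z (k + 2) (suc j))
    ≡⟨ x∧[y∧z]≡y∧[x∧z] (z (k + 2 + 2 * suc j)) (not (z (k + 1))) (oddZeros z (k + 2) (suc j)) ⟩
  not (z (k + 1)) ∧ γˢ (suc j) z (k + 2) ∎
  where
  open ≡-Reasoning
  shift : ∀ k j → k + 2 * suc (suc j) ≡ k + 2 + 2 * suc j
  shift = solve-∀

applyPolyFromˢ-suc : ∀ i B z k → applyPolyFromˢ (suc i) B z k ≡ not (z (k + 1)) ∧ applyPolyFromˢ i B z (k + 2)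
applyPolyFromˢ-suc i []      z k = sym (∧-zeroʳ _)
applyPolyFromˢ-suc i (b ∷ B) z k = begin
  (b ∧ γˢ (suc i) z k) xor applyPolyFromˢ (suc (suc i)) B z k
    ≡⟨ cong₂ _xor_ (cong (b ∧_) (γˢ-suc i z k)) (applyPolyFromˢ-suc (suc i) B z k) ⟩
  (b ∧ (not (z (k + 1)) ∧ γˢ i z (k + 2))) xor (not (z (k + 1)) ∧ applyPolyFromˢ (suc i) B z (k + 2))
    ≡⟨ cong (_xor _) (x∧[y∧z]≡y∧[x∧z] b (not (z (k + 1))) (γˢ i z (k + 2))) ⟩
  (not (z (k + 1)) ∧ (b ∧ γˢ i z (k + 2))) xor (not (z (k + 1)) ∧ applyPolyFromˢ (suc i) B z (k + 2))
    ≡⟨ ∧-distribˡ-xor (not (z (k + 1))) _ _ ⟨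
  not (z (k + 1)) ∧ applyPolyFromˢ i (b ∷ B) z (k + 2) ∎
  where open ≡-Reasoning

applyPolyFromˢ-+P : ∀ i P Q z k → applyPolyFromˢ i (P +P Q) z k ≡ applyPolyFromˢ i P z k xor applyPolyFromˢ i Q z k
applyPolyFromˢ-+P i []      Q       z k = refl
applyPolyFromˢ-+P i (a ∷ P) []      z k = sym (xor-identityʳ _)
applyPolyFromˢ-+P i (a ∷ P) (b ∷ Q) z k = begin
  ((a xor b) ∧ γˢ i z k) xor applyPolyFromˢ (suc i) (P +P Q) z k
    ≡⟨ cong₂ _xor_ (∧-distribʳ-xor (γˢ i z k) a b) (applyPolyFromˢ-+P (suc i) P Q z k) ⟩
  ((a ∧ γˢ i z k) xor (b ∧ γˢ i z k)) xor (applyPolyFromˢ (suc i) P z k xor applyPolyFromˢ (suc i) Q z k)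
    ≡⟨ xor-interchange (a ∧ γˢ i z k) (b ∧ γˢ i z k) (applyPolyFromˢ (suc i) P z k) (applyPolyFromˢ (suc i) Q z k) ⟩
  applyPolyFromˢ i (a ∷ P) z k xor applyPolyFromˢ i (b ∷ Q) z k ∎
  where open ≡-Reasoning

applyPolyFromˢ-≋ : ∀ i {P Q} z k → P ≋ Q → applyPolyFromˢ i P z k ≡ applyPolyFromˢ i Q z k
applyPolyFromˢ-≋ i {[]}    {[]}    z k P≋Q = refl
applyPolyFromˢ-≋ i {[]}    {b ∷ Q} z k P≋Q rewrite sym (coeffwise P≋Q 0) =
  applyPolyFromˢ-≋ (suc i) {[]} {Q} z k (mk≋ λ j → coeffwise P≋Q (suc j))
applyPolyFromˢ-≋ i {a ∷ P} {[]}    z k P≋Q rewrite coeffwise P≋Q 0 =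
  applyPolyFromˢ-≋ (suc i) {P} {[]} z k (mk≋ λ j → coeffwise P≋Q (suc j))
applyPolyFromˢ-≋ i {a ∷ P} {b ∷ Q} z k P≋Q = cong₂ _xor_ (cong (_∧ γˢ i z k) (coeffwise P≋Q 0))
  (applyPolyFromˢ-≋ (suc i) {P} {Q} z k (mk≋ λ j → coeffwise P≋Q (suc j)))

applyPolyFromˢ-X^ : ∀ a i z k → applyPolyFromˢ i (X^ a) z k ≡ γˢ (a + i) z k
applyPolyFromˢ-X^ zero    i z k = xor-identityʳ _
applyPolyFromˢ-X^ (suc a) i z k = trans (applyPolyFromˢ-X^ a (suc i) z k) (cong (λ t → γˢ t z k) (+-suc a i))

γˢ-disjoint : ∀ s t z m → (γˢ s z m ∧ not (z m)) ∧ γˢ t z (m + 1) ≡ false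
γˢ-disjoint zero    t       z m with z m
... | true  = refl
... | false = refl
γˢ-disjoint (suc s) zero    z m = begin
  (γˢ (suc s) z m ∧ not (z m)) ∧ z (m + 1)
    ≡⟨ cong (λ g → (g ∧ not (z m)) ∧ z (m + 1)) (γˢ-suc s z m) ⟩
  ((not (z (m + 1)) ∧ γˢ s z (m + 2)) ∧ not (z m)) ∧ z (m + 1)
    ≡⟨ not-∧-∧-same (z (m + 1)) _ _ ⟩
  false ∎
  where
  open ≡-Reasoning
  not-∧-∧-same : ∀ a x y → ((not a ∧ x) ∧ y) ∧ a ≡ false
  not-∧-∧-same false x y = ∧-zeroʳ _
  not-∧-∧-same true  x y = refl
γˢ-disjoint (suc s) (suc t) z m = begin
  (γˢ (suc s) z m ∧ not (z m)) ∧ γˢ (suc t) z (m + 1)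
    ≡⟨ cong₂ (λ g h → (g ∧ not (z m)) ∧ h) (γˢ-suc s z m) γˢ-suc-at-m+1 ⟩
  ((not (z (m + 1)) ∧ γˢ s z (m + 2)) ∧ not (z m)) ∧ (not (z (m + 2)) ∧ γˢ t z (m + 2 + 1))
    ≡⟨ widen (not (z (m + 1))) _ (not (z m)) _ _ (γˢ-disjoint s t z (m + 2)) ⟩
  false ∎
  where
  open ≡-Reasoning
  m+1+2≡m+2+1 : ∀ m → m + 1 + 2 ≡ m + 2 + 1
  m+1+2≡m+2+1 = solve-∀
  γˢ-suc-at-m+1 : γˢ (suc t) z (m + 1) ≡ not (z (m + 2)) ∧ γˢ t z (m + 2 + 1)
  γˢ-suc-at-m+1 = trans (γˢ-suc t z (m + 1)) (cong₂ (λ p q → not (z p) ∧ γˢ t z q) (+-assoc m 1 1) (m+1+2≡m+2+1 m))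
  widen : ∀ u g v c h → (g ∧ c) ∧ h ≡ false → ((u ∧ g) ∧ v) ∧ (c ∧ h) ≡ false
  widen false g     v     c h _ = refl
  widen true  false v     c h _ = refl
  widen true  true  false c h _ = refl
  widen true  true  true  c h e = e

applyPolyFromˢ-∧-false : ∀ {w} i B z m → (∀ s → w ∧ γˢ s z m ≡ false) → w ∧ applyPolyFromˢ i B z m ≡ false
applyPolyFromˢ-∧-false     i []      z m w∧γ≡false = ∧-zeroʳ _
applyPolyFromˢ-∧-false {w} i (b ∷ B) z m w∧γ≡false = begin
  w ∧ ((b ∧ γˢ i z m) xor applyPolyFromˢ (suc i) B z m)
    ≡⟨ ∧-distribˡ-xor w _ _ ⟩
  (w ∧ (b ∧ γˢ i z m)) xor (w ∧ applyPolyFromˢ (suc i) B z m)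
    ≡⟨ cong₂ _xor_ first (applyPolyFromˢ-∧-false (suc i) B z m w∧γ≡false) ⟩
  false ∎
  where
  open ≡-Reasoning
  first : w ∧ (b ∧ γˢ i z m) ≡ false
  first = trans (x∧[y∧z]≡y∧[x∧z] w b (γˢ i z m)) (trans (cong (b ∧_) (w∧γ≡false i)) (∧-zeroʳ b))

applyPolyFromˢ-disjoint : ∀ a B c C z m → applyPolyFromˢ a B z m ∧ (not (z m) ∧ applyPolyFromˢ c C z (m + 1)) ≡ false
applyPolyFromˢ-disjoint a B c C z m = trans (∧-comm (applyPolyFromˢ a B z m) _)
  (applyPolyFromˢ-∧-false a B z m λ s →
    trans ([x∧y]∧z≡[z∧x]∧y (not (z m)) (applyPolyFromˢ c C z (m + 1)) (γˢ s z m))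
      (applyPolyFromˢ-∧-false c C z (m + 1) (λ t → γˢ-disjoint s t z m)))

-- Write y_{k+1} = z_{k+1} + o: the correction o never meets the remaining factor γ_{2a}(y)_{k+2},
-- so the factor 1 + y_{k+1} of γ_{2(a+1)}(y)_k may be replaced by 1 + z_{k+1}.
γˢ-∘-applyPolyˢ : ∀ B z y → (∀ k → y k ≡ applyPolyˢ (true ∷ B) z k) →
                  ∀ a k → γˢ a y k ≡ applyPolyFromˢ a (true ∷ B) z k
γˢ-∘-applyPolyˢ B z y y≡ zero    k = y≡ k
γˢ-∘-applyPolyˢ B z y y≡ (suc a) k = begin
  γˢ (suc a) y k
    ≡⟨ γˢ-suc a y k ⟩
  not (y (k + 1)) ∧ γˢ a y (k + 2)
    ≡⟨ cong₂ (λ u v → not u ∧ v) (y≡ (k + 1)) (γˢ-∘-applyPolyˢ B z y y≡ a (k + 2)) ⟩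
  not (z (k + 1) xor o) ∧ e
    ≡⟨ drop-disjoint (z (k + 1)) o e e∧o≡false ⟩
  not (z (k + 1)) ∧ e
    ≡⟨ applyPolyFromˢ-suc a (true ∷ B) z k ⟨
  applyPolyFromˢ (suc a) (true ∷ B) z k ∎
  where
  open ≡-Reasoning
  o = applyPolyFromˢ 1 B z (k + 1)
  e = applyPolyFromˢ a (true ∷ B) z (k + 2)
  o≡ : o ≡ not (z (k + 2)) ∧ applyPolyFromˢ 0 B z (k + 2 + 1)
  o≡ = trans (applyPolyFromˢ-suc 0 B z (k + 1))
    (cong₂ (λ p q → not (z p) ∧ applyPolyFromˢ 0 B z q) (+-assoc k 1 1) (trans (+-assoc k 1 2) (sym (+-assoc k 2 1))))
  e∧o≡false : e ∧ o ≡ false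
  e∧o≡false = trans (cong (e ∧_) o≡) (applyPolyFromˢ-disjoint a (true ∷ B) 0 B z (k + 2))
  drop-disjoint : ∀ a o e → e ∧ o ≡ false → not (a xor o) ∧ e ≡ not a ∧ e
  drop-disjoint a false e _  = cong (λ t → not t ∧ e) (xor-identityʳ a)
  drop-disjoint a true  false _ = trans (∧-zeroʳ _) (sym (∧-zeroʳ _))
  drop-disjoint a true  true  ()

applyPolyFromˢ-∘ : ∀ B z y → (∀ k → y k ≡ applyPolyˢ (true ∷ B) z k) →
                   ∀ i A k → applyPolyFromˢ i A y k ≡ applyPolyFromˢ i (A *P (true ∷ B)) z k
applyPolyFromˢ-∘ B z y y≡ i []      k = refl
applyPolyFromˢ-∘ B z y y≡ i (a ∷ A) k = begin
  (a ∧ γˢ i y k) xor applyPolyFromˢ (suc i) A y k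
    ≡⟨ cong₂ _xor_ (cong (a ∧_) (γˢ-∘-applyPolyˢ B z y y≡ i k)) (applyPolyFromˢ-∘ B z y y≡ (suc i) A k) ⟩
  (a ∧ applyPolyFromˢ i (true ∷ B) z k) xor applyPolyFromˢ i (false ∷ (A *P (true ∷ B))) z k
    ≡⟨ cong (_xor _) (scale a) ⟩
  applyPolyFromˢ i (if a then true ∷ B else []) z k xor applyPolyFromˢ i (false ∷ (A *P (true ∷ B))) z k
    ≡⟨ applyPolyFromˢ-+P i (if a then true ∷ B else []) (false ∷ (A *P (true ∷ B))) z k ⟨
  applyPolyFromˢ i ((a ∷ A) *P (true ∷ B)) z k ∎
  where
  open ≡-Reasoning
  scale : ∀ a → a ∧ applyPolyFromˢ i (true ∷ B) z k ≡ applyPolyFromˢ i (if a then true ∷ B else []) z k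
  scale false = refl
  scale true  = refl

-- Inverting κ

oddZeros-true : ∀ z k j → oddZeros z k j ≡ true → ∀ {t} → t < j → z (k + (2 * t + 1)) ≡ false
oddZeros-true z k (suc j) zeros t<1+j with oddZeros z k j in zerosⱼ | z (k + (2 * j + 1)) in zⱼ
oddZeros-true z k (suc j) zeros t<1+j | true | false with m<1+n⇒m<n∨m≡n t<1+j
... | inj₁ t<j  = oddZeros-true z k j zerosⱼ t<j
... | inj₂ refl = zⱼ
oddZeros-true z k (suc j) () t<1+j | true  | true
oddZeros-true z k (suc j) () t<1+j | false | _

-- n = 2h + 1: z_{k+2(h+1+d)} = z_{k+2d+1}, and oddZeros asks the latter to vanish.
γˢ-vanishes : ∀ h z → Periodic (suc (2 * h)) z → ∀ d k → γˢ (suc h + d) z k ≡ false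
γˢ-vanishes h z per d k with oddZeros z k (suc (h + d)) in zeros
... | false = ∧-zeroʳ _
... | true  = trans (∧-identityʳ _) (begin
  z (k + 2 * suc (h + d))            ≡⟨ cong z (shift k h d) ⟩
  z (k + (2 * d + 1) + suc (2 * h))  ≡⟨ per _ ⟩
  z (k + (2 * d + 1))                ≡⟨ oddZeros-true z k (suc (h + d)) zeros (s≤s (m≤n+m d h)) ⟩
  false                              ∎)
  where
  open ≡-Reasoning
  shift : ∀ k h d → k + 2 * suc (h + d) ≡ k + (2 * d + 1) + suc (2 * h)
  shift = solve-∀

-- n = 2H: once j ≥ H the odd offsets 1, 3, …, 2j − 1 cover every odd residue modulo n.
oddZeros-saturates : ∀ h z → Periodic (suc h + suc h) z → ∀ d k → oddZeros z k (suc h + d) ≡ oddZeros z k (suc h)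
oddZeros-saturates h z per zero    k = cong (oddZeros z k) (+-identityʳ (suc h))
oddZeros-saturates h z per (suc d) k =
  trans (cong (oddZeros z k) (+-suc (suc h) d)) (trans step (oddZeros-saturates h z per d k))
  where
  shift : ∀ k h d → k + (2 * (suc h + d) + 1) ≡ k + (2 * d + 1) + (suc h + suc h)
  shift = solve-∀
  step : oddZeros z k (suc h + d) ∧ not (z (k + (2 * (suc h + d) + 1))) ≡ oddZeros z k (suc h + d)
  step with oddZeros z k (suc h + d) in zeros
  ... | false = refl
  ... | true  = cong not (trans (cong z (shift k h d))
                  (trans (per _) (oddZeros-true z k (suc h + d) zeros (s≤s (m≤n+m d h)))))

γˢ-saturated : ∀ h z → Periodic (suc h + suc h) z → ∀ c k → γˢ (suc h + c) z k ≡ z (k + 2 * c) ∧ oddZeros z k (suc h)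
γˢ-saturated h z per c k = trans (γˢ-form (suc h + c) z k)
  (cong₂ _∧_ (trans (cong z (shift k h c)) (per _)) (oddZeros-saturates h z per c k))
  where
  shift : ∀ k h c → k + 2 * (suc h + c) ≡ k + 2 * c + (suc h + suc h)
  shift = solve-∀

γˢ-periodic : ∀ h z → Periodic (suc h + suc h) z → ∀ d k → γˢ (suc h + d + suc h) z k ≡ γˢ (suc h + d) z k
γˢ-periodic h z per d k = begin
  γˢ (suc h + d + suc h) z k                            ≡⟨ cong (λ t → γˢ t z k) (+-assoc (suc h) d (suc h)) ⟩
  γˢ (suc h + (d + suc h)) z k                          ≡⟨ γˢ-saturated h z per (d + suc h) k ⟩
  z (k + 2 * (d + suc h)) ∧ oddZeros z k (suc h)        ≡⟨ cong (λ t → z t ∧ oddZeros z k (suc h)) (shift k h d) ⟩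
  z (k + 2 * d + (suc h + suc h)) ∧ oddZeros z k (suc h) ≡⟨ cong (_∧ oddZeros z k (suc h)) (per _) ⟩
  z (k + 2 * d) ∧ oddZeros z k (suc h)                  ≡⟨ γˢ-saturated h z per d k ⟨
  γˢ (suc h + d) z k                                    ∎
  where
  open ≡-Reasoning
  shift : ∀ k h d → k + 2 * (d + suc h) ≡ k + 2 * d + (suc h + suc h)
  shift = solve-∀

Kills : Poly → Seq → Set
Kills M z = ∀ i k → applyPolyFromˢ i M z k ≡ false

X^-kills : ∀ h z → Periodic (suc (2 * h)) z → Kills (X^ (suc h)) z
X^-kills h z per i k = trans (applyPolyFromˢ-X^ (suc h) i z k) (γˢ-vanishes h z per i k)

X^+X^-kills : ∀ h z → Periodic (suc h + suc h) z → Kills (X^ (suc h + suc h) +P X^ (suc h)) z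
X^+X^-kills h z per i k = begin
  applyPolyFromˢ i (X^ (H + H) +P X^ H) z k
    ≡⟨ applyPolyFromˢ-+P i (X^ (H + H)) (X^ H) z k ⟩
  applyPolyFromˢ i (X^ (H + H)) z k xor applyPolyFromˢ i (X^ H) z k
    ≡⟨ cong₂ _xor_ (applyPolyFromˢ-X^ (H + H) i z k) (applyPolyFromˢ-X^ H i z k) ⟩
  γˢ (H + H + i) z k xor γˢ (H + i) z k
    ≡⟨ cong (λ t → γˢ t z k xor γˢ (H + i) z k) (x+x+y≡x+y+x H i) ⟩
  γˢ (H + i + H) z k xor γˢ (H + i) z k
    ≡⟨ cong (_xor γˢ (H + i) z k) (γˢ-periodic h z per i k) ⟩
  γˢ (H + i) z k xor γˢ (H + i) z k
    ≡⟨ xor-same (γˢ (H + i) z k) ⟩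
  false ∎
  where
  open ≡-Reasoning
  H = suc h
  x+x+y≡x+y+x : ∀ x y → x + x + y ≡ x + y + x
  x+x+y≡x+y+x = solve-∀

Kills-multiples : ∀ {M z} → Kills M z → ∀ q i k → applyPolyFromˢ i (q *P M) z k ≡ false
Kills-multiples         kills []      i k = refl
Kills-multiples {M} {z} kills (a ∷ q) i k = begin
  applyPolyFromˢ i ((if a then M else []) +P (false ∷ (q *P M))) z k
    ≡⟨ applyPolyFromˢ-+P i (if a then M else []) (false ∷ (q *P M)) z k ⟩
  applyPolyFromˢ i (if a then M else []) z k xor applyPolyFromˢ (suc i) (q *P M) z k
    ≡⟨ cong₂ _xor_ (scaled a) (Kills-multiples kills q (suc i) k) ⟩
  false ∎
  where
  open ≡-Reasoning
  scaled : ∀ a → applyPolyFromˢ i (if a then M else []) z k ≡ false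
  scaled false = refl
  scaled true  = kills i k

applyPolyˢ-≡-id : ∀ {M z} C → Kills M z → CongMod M C oneP → ∀ k → applyPolyˢ C z k ≡ z k
applyPolyˢ-≡-id {M} {z} C kills (q , C+1≈qM) k = xor≡false⇒≡ (begin
  applyPolyˢ C z k xor z k                       ≡⟨ cong (applyPolyˢ C z k xor_) (xor-identityʳ (z k)) ⟨
  applyPolyˢ C z k xor applyPolyˢ oneP z k       ≡⟨ applyPolyFromˢ-+P 0 C oneP z k ⟨
  applyPolyˢ (C +P oneP) z k                     ≡⟨ applyPolyFromˢ-≋ 0 {C +P oneP} {q *P M} z k (mk≋ C+1≈qM) ⟩
  applyPolyˢ (q *P M) z k                        ≡⟨ Kills-multiples kills q 0 k ⟩
  false                                          ∎)
  where
  open ≡-Reasoning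
  xor≡false⇒≡ : ∀ {a b} → a xor b ≡ false → a ≡ b
  xor≡false⇒≡ {false} {false} _ = refl
  xor≡false⇒≡ {true}  {true}  _ = refl

coord-γprod : ∀ {m} (x : Vec Bool (suc m)) j k → coord (γprod j x) k ≡ oddZeros (coord x) k j
coord-γprod x zero    k = coord-replicate true k
coord-γprod x (suc j) k = begin
  coord (γprod j x ⊙ (𝟙 ⊕ S^ (2 * j + 1) x)) k
    ≡⟨ coord-zipWith _∧_ (γprod j x) _ k ⟩
  coord (γprod j x) k ∧ coord (𝟙 ⊕ S^ (2 * j + 1) x) k
    ≡⟨ cong₂ _∧_ (coord-γprod x j k) (coord-zipWith _xor_ 𝟙 _ k) ⟩
  oddZeros (coord x) k j ∧ (coord 𝟙 k xor coord (S^ (2 * j + 1) x) k)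
    ≡⟨ cong₂ (λ u v → oddZeros (coord x) k j ∧ (u xor v)) (coord-replicate true k) (coord-S^ x (2 * j + 1) k) ⟩
  oddZeros (coord x) k (suc j) ∎
  where open ≡-Reasoning

coord-γ : ∀ {m} (x : Vec Bool (suc m)) j k → coord (γ j x) k ≡ γˢ j (coord x) k
coord-γ x zero    k = refl
coord-γ x (suc j) k = trans (coord-zipWith _∧_ (S^ (2 * suc j) x) (γprod (suc j) x) k)
  (cong₂ _∧_ (coord-S^ x (2 * suc j) k) (coord-γprod x (suc j) k))

coord-applyPolyFrom : ∀ {m} (x : Vec Bool (suc m)) i B k →
                      coord (applyPolyFrom i B x) k ≡ applyPolyFromˢ i B (coord x) k
coord-applyPolyFrom x i []      k = coord-replicate false k
coord-applyPolyFrom x i (b ∷ B) k = trans (coord-zipWith _xor_ _ _ k)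
  (cong₂ _xor_ (term b) (coord-applyPolyFrom x (suc i) B k))
  where
  term : ∀ b → coord (if b then γ i x else 𝟘) k ≡ b ∧ γˢ i (coord x) k
  term false = coord-replicate false k
  term true  = coord-γ x i k

κ≡applyPoly-oneXX : ∀ {n} (x : Vec Bool n) → κ x ≡ applyPoly oneXX x
κ≡applyPoly-oneXX x = cong (λ v → x ⊕ (γ 1 x ⊕ v)) (sym (zipWith-identityʳ xor-identityʳ (γ 2 x)))

applyPoly-∘ : ∀ {m} A B → coeff B 0 ≡ true → (x : Vec Bool (suc m)) → applyPoly A (applyPoly B x) ≡ applyPoly (A *P B) x
applyPoly-∘ A (b ∷ B) refl x = coord-ext λ k → begin
  coord (applyPoly A (applyPoly (true ∷ B) x)) k
    ≡⟨ coord-applyPolyFrom (applyPoly (true ∷ B) x) 0 A k ⟩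
  applyPolyˢ A (coord (applyPoly (true ∷ B) x)) k
    ≡⟨ applyPolyFromˢ-∘ B (coord x) _ (coord-applyPolyFrom x 0 (true ∷ B)) 0 A k ⟩
  applyPolyˢ (A *P (true ∷ B)) (coord x) k
    ≡⟨ coord-applyPolyFrom x 0 (A *P (true ∷ B)) k ⟨
  coord (applyPoly (A *P (true ∷ B)) x) k ∎
  where open ≡-Reasoning

applyPoly-≡-id : ∀ {m M} C (x : Vec Bool (suc m)) → Kills M (coord x) → CongMod M C oneP → applyPoly C x ≡ x
applyPoly-≡-id C x kills C≡1 = coord-ext λ k →
  trans (coord-applyPolyFrom x 0 C k) (applyPolyˢ-≡-id C kills C≡1 k)

CongMod-≋ : ∀ {M p p' c} → p ≋ p' → CongMod M p c → CongMod M p' c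
CongMod-≋ {c = c} p≋p' (q , p+c≈qM) = q , λ i → trans (sym (coeffwise (+P-congʳ c p≋p') i)) (p+c≈qM i)

InvOfκ-from-congruence : ∀ {m} M B → (∀ (x : Vec Bool (suc m)) → Kills M (coord x)) →
            coeff B 0 ≡ true → CongMod M (oneXX *P B) oneP → InvOfκ (suc m) B
InvOfκ-from-congruence M B kills b₀ LB≡1 x = left , right
  where
  open ≡-Reasoning
  left : applyPoly B (κ x) ≡ x
  left = begin
    applyPoly B (κ x)               ≡⟨ cong (applyPoly B) (κ≡applyPoly-oneXX x) ⟩
    applyPoly B (applyPoly oneXX x) ≡⟨ applyPoly-∘ B oneXX refl x ⟩
    applyPoly (B *P oneXX) x        ≡⟨ applyPoly-≡-id (B *P oneXX) x (kills x) (CongMod-≋ (*P-comm oneXX B) LB≡1) ⟩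
    x                               ∎
  right : κ (applyPoly B x) ≡ x
  right = begin
    κ (applyPoly B x)               ≡⟨ κ≡applyPoly-oneXX (applyPoly B x) ⟩
    applyPoly oneXX (applyPoly B x) ≡⟨ applyPoly-∘ oneXX B b₀ x ⟩
    applyPoly (oneXX *P B) x        ≡⟨ applyPoly-≡-id (oneXX *P B) x (kills x) LB≡1 ⟩
    x                               ∎

InvOfκ-odd : ∀ h B → coeff B 0 ≡ true → CongMod (X^ (suc h)) (oneXX *P B) oneP → InvOfκ (suc (2 * h)) B
InvOfκ-odd h B = InvOfκ-from-congruence (X^ (suc h)) B (λ x → X^-kills h (coord x) (coord-periodic x))

InvOfκ-even : ∀ h B → coeff B 0 ≡ true → CongMod (X^ (suc h + suc h) +P X^ (suc h)) (oneXX *P B) oneP →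
                 InvOfκ (suc h + suc h) B
InvOfκ-even h B = InvOfκ-from-congruence (X^ (suc h + suc h) +P X^ (suc h)) B (λ x → X^+X^-kills h (coord x) (coord-periodic x))

-- Algebraic degree

AnfDegLe : ∀ {n} → (Vec Bool n → Bool) → ℕ → Set
AnfDegLe {n} f d = ∃[ p ] (All (λ (u : Subset n) → ∣ u ∣ ≤ d) p × (∀ x → polyEval p x ≡ f x))

AnfDegLe-cong : ∀ {n} {f g : Vec Bool n → Bool} {d} → (∀ x → f x ≡ g x) → AnfDegLe f d → AnfDegLe g d
AnfDegLe-cong f≗g (p , small , eval) = p , small , λ x → trans (eval x) (f≗g x)

AnfDegLe-mono : ∀ {n} {f : Vec Bool n → Bool} {d d'} → d ≤ d' → AnfDegLe f d → AnfDegLe f d'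
AnfDegLe-mono d≤d' (p , small , eval) = p , All.map (λ small-u → ≤-trans small-u d≤d') small , eval

AnfDegLe-false : ∀ {n} d → AnfDegLe {n} (λ _ → false) d
AnfDegLe-false d = [] , [] , λ x → refl

monoEval-⊥ : ∀ {n} (x : Vec Bool n) → monoEval ⊥ x ≡ true
monoEval-⊥ []      = refl
monoEval-⊥ (a ∷ x) = monoEval-⊥ x

AnfDegLe-true : ∀ {n} d → AnfDegLe {n} (λ _ → true) d
AnfDegLe-true {n} d = ⊥ ∷ [] , subst (_≤ d) (sym (∣⊥∣≡0 n)) z≤n ∷ [] , λ x → trans (xor-identityʳ _) (monoEval-⊥ x)

monoEval-⁅⁆ : ∀ {n} (j : Fin n) (x : Vec Bool n) → monoEval ⁅ j ⁆ x ≡ lookup x j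
monoEval-⁅⁆ fzero    (a ∷ x) = trans (cong (a ∧_) (monoEval-⊥ x)) (∧-identityʳ a)
monoEval-⁅⁆ (fsuc j) (a ∷ x) = monoEval-⁅⁆ j x

AnfDegLe-lookup : ∀ {n} (j : Fin n) → AnfDegLe (λ x → lookup x j) 1
AnfDegLe-lookup j = ⁅ j ⁆ ∷ [] , ≤-reflexive (∣⁅x⁆∣≡1 j) ∷ [] , λ x → trans (xor-identityʳ _) (monoEval-⁅⁆ j x)

polyEval-++ : ∀ {n} (p q : List (Subset n)) x → polyEval (p ++ q) x ≡ polyEval p x xor polyEval q x
polyEval-++ []      q x = refl
polyEval-++ (u ∷ p) q x = trans (cong (monoEval u x xor_) (polyEval-++ p q x)) (sym (xor-assoc (monoEval u x) _ _))

AnfDegLe-xor : ∀ {n} {f g : Vec Bool n → Bool} {d} → AnfDegLe f d → AnfDegLe g d → AnfDegLe (λ x → f x xor g x) d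
AnfDegLe-xor (p , p-small , p-eval) (q , q-small , q-eval) =
  p ++ q , Allₚ.++⁺ p-small q-small , λ x → trans (polyEval-++ p q x) (cong₂ _xor_ (p-eval x) (q-eval x))

AnfDegLe-not : ∀ {n} {f : Vec Bool n → Bool} {d} → AnfDegLe f d → AnfDegLe (λ x → not (f x)) d
AnfDegLe-not {d = d} = AnfDegLe-xor (AnfDegLe-true d)

monoEval-∪ : ∀ {n} (u v : Subset n) x → monoEval (u ∪ v) x ≡ monoEval u x ∧ monoEval v x
monoEval-∪ []      []      []      = refl
monoEval-∪ (a ∷ u) (b ∷ v) (c ∷ x) = trans (cong₂ _∧_ (factor a b) (monoEval-∪ u v x))
  (∧-interchange (if a then c else true) (if b then c else true) (monoEval u x) (monoEval v x))
  where
  factor : ∀ a b → (if a ∨ b then c else true) ≡ (if a then c else true) ∧ (if b then c else true)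
  factor false b     = refl
  factor true  false = sym (∧-identityʳ c)
  factor true  true  = sym (∧-idem c)

∣∪∣≤ : ∀ {n} (u v : Subset n) → ∣ u ∪ v ∣ ≤ ∣ u ∣ + ∣ v ∣
∣∪∣≤ []          []          = z≤n
∣∪∣≤ (false ∷ u) (false ∷ v) = ∣∪∣≤ u v
∣∪∣≤ (false ∷ u) (true ∷ v)  = subst (suc ∣ u ∪ v ∣ ≤_) (sym (+-suc ∣ u ∣ ∣ v ∣)) (s≤s (∣∪∣≤ u v))
∣∪∣≤ (true ∷ u)  (false ∷ v) = s≤s (∣∪∣≤ u v)
∣∪∣≤ (true ∷ u)  (true ∷ v)  = s≤s (≤-trans (∣∪∣≤ u v) (+-monoʳ-≤ ∣ u ∣ (n≤1+n ∣ v ∣)))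

-- x_i² = x_i is built into _∪_; repeated monomials are kept and cancel in polyEval
_·anf_ : ∀ {n} → List (Subset n) → List (Subset n) → List (Subset n)
[]      ·anf q = []
(u ∷ p) ·anf q = List.map (u ∪_) q ++ (p ·anf q)

polyEval-·anf : ∀ {n} (p q : List (Subset n)) x → polyEval (p ·anf q) x ≡ polyEval p x ∧ polyEval q x
polyEval-·anf []      q x = refl
polyEval-·anf (u ∷ p) q x = begin
  polyEval (List.map (u ∪_) q ++ (p ·anf q)) x                      ≡⟨ polyEval-++ (List.map (u ∪_) q) (p ·anf q) x ⟩
  polyEval (List.map (u ∪_) q) x xor polyEval (p ·anf q) x          ≡⟨ cong₂ _xor_ (polyEval-map-∪ q) (polyEval-·anf p q x) ⟩
  (monoEval u x ∧ polyEval q x) xor (polyEval p x ∧ polyEval q x)   ≡⟨ ∧-distribʳ-xor (polyEval q x) (monoEval u x) _ ⟨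
  polyEval (u ∷ p) x ∧ polyEval q x                                 ∎
  where
  open ≡-Reasoning
  polyEval-map-∪ : ∀ q → polyEval (List.map (u ∪_) q) x ≡ monoEval u x ∧ polyEval q x
  polyEval-map-∪ []      = sym (∧-zeroʳ _)
  polyEval-map-∪ (v ∷ q) = trans (cong₂ _xor_ (monoEval-∪ u v x) (polyEval-map-∪ q))
    (sym (∧-distribˡ-xor (monoEval u x) _ _))

·anf-small : ∀ {n d e} (p q : List (Subset n)) → All (λ u → ∣ u ∣ ≤ d) p → All (λ v → ∣ v ∣ ≤ e) q →
             All (λ w → ∣ w ∣ ≤ d + e) (p ·anf q)
·anf-small []      q []             q-small = []
·anf-small (u ∷ p) q (u-small ∷ p-small) q-small =
  Allₚ.++⁺ (Allₚ.map⁺ (All.map (λ v-small → ≤-trans (∣∪∣≤ u _) (+-mono-≤ u-small v-small)) q-small))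
          (·anf-small p q p-small q-small)

AnfDegLe-∧ : ∀ {n} {f g : Vec Bool n → Bool} {d e} → AnfDegLe f d → AnfDegLe g e → AnfDegLe (λ x → f x ∧ g x) (d + e)
AnfDegLe-∧ (p , p-small , p-eval) (q , q-small , q-eval) =
  p ·anf q , ·anf-small p q p-small q-small , λ x → trans (polyEval-·anf p q x) (cong₂ _∧_ (p-eval x) (q-eval x))

AnfDegLe-coord : ∀ {m} k → AnfDegLe {suc m} (λ x → coord x k) 1
AnfDegLe-coord k = AnfDegLe-cong (λ x → sym (coord-pos x k)) (AnfDegLe-lookup (pos k))

AnfDegLe-oddZeros : ∀ {m} k j → AnfDegLe {suc m} (λ x → oddZeros (coord x) k j) j
AnfDegLe-oddZeros k zero    = AnfDegLe-true 0
AnfDegLe-oddZeros k (suc j) = AnfDegLe-mono (≤-reflexive (+-comm j 1))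
  (AnfDegLe-∧ (AnfDegLe-oddZeros k j) (AnfDegLe-not (AnfDegLe-coord (k + (2 * j + 1)))))

AnfDegLe-γˢ : ∀ {m} j k → AnfDegLe {suc m} (λ x → γˢ j (coord x) k) (suc j)
AnfDegLe-γˢ zero    k = AnfDegLe-coord k
AnfDegLe-γˢ (suc j) k = AnfDegLe-∧ (AnfDegLe-coord (k + 2 * suc j)) (AnfDegLe-oddZeros k (suc j))

AnfDegLe-combFrom : ∀ {n} {ψ : Vec Bool n → ℕ → Bool} {d} i B →
  (∀ t → coeff B t ≡ true → AnfDegLe (λ x → ψ x (i + t)) d) → AnfDegLe (λ x → combFrom i B (ψ x)) d
AnfDegLe-combFrom {d = d} i []      small = AnfDegLe-false d
AnfDegLe-combFrom {n} {ψ} {d} i (b ∷ B) small =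
  AnfDegLe-xor (head-term b (small 0)) (AnfDegLe-combFrom (suc i) B tail-small)
  where
  head-term : ∀ b → (b ≡ true → AnfDegLe (λ x → ψ x (i + 0)) d) → AnfDegLe (λ x → b ∧ ψ x i) d
  head-term false _      = AnfDegLe-false d
  head-term true  small₀ = AnfDegLe-cong (λ x → cong (ψ x) (+-identityʳ i)) (small₀ refl)
  tail-small : ∀ t → coeff B t ≡ true → AnfDegLe (λ x → ψ x (suc i + t)) d
  tail-small t bₜ = AnfDegLe-cong (λ x → cong (ψ x) (+-suc i t)) (small (suc t) bₜ)

DegLe-applyPoly : ∀ {m} B d → (∀ t → coeff B t ≡ true → ∀ k → AnfDegLe {suc m} (λ x → γˢ t (coord x) k) d) →
                  DegLe (applyPoly {suc m} B) d
DegLe-applyPoly B d γ-small i = AnfDegLe-cong coordinate (AnfDegLe-combFrom 0 B λ t bₜ → γ-small t bₜ (toℕ i))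
  where
  coordinate : ∀ x → applyPolyFromˢ 0 B (coord x) (toℕ i) ≡ lookup (applyPoly B x) i
  coordinate x = sym (trans (lookup-coord (applyPoly B x) i) (coord-applyPolyFrom x 0 B (toℕ i)))

DegLe-applyPoly-≤ : ∀ {m} B J → DegBelow B (suc J) → DegLe (applyPoly {suc m} B) (suc J)
DegLe-applyPoly-≤ B J below = DegLe-applyPoly B (suc J) λ t bₜ k → AnfDegLe-mono (DegBelow⇒< below bₜ) (AnfDegLe-γˢ t k)

DegLe-applyPoly-even : ∀ h B → DegLe (applyPoly {suc h + suc h} B) (suc (suc h))
DegLe-applyPoly-even h B = DegLe-applyPoly B (suc (suc h)) small
  where
  small : ∀ t → coeff B t ≡ true → ∀ k → AnfDegLe (λ x → γˢ t (coord x) k) (suc (suc h))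
  small t _ k with t ≤? suc h
  ... | yes t≤1+h = AnfDegLe-mono (s≤s t≤1+h) (AnfDegLe-γˢ t k)
  ... | no  t≰1+h = AnfDegLe-cong saturated (AnfDegLe-∧ (AnfDegLe-coord (k + 2 * c)) (AnfDegLe-oddZeros k (suc h)))
    where
    c = t ∸ suc h
    1+h+c≡t : suc h + c ≡ t
    1+h+c≡t = m+[n∸m]≡n (<⇒≤ (≰⇒> t≰1+h))
    saturated : ∀ x → coord x (k + 2 * c) ∧ oddZeros (coord x) k (suc h) ≡ γˢ t (coord x) k
    saturated x = trans (sym (γˢ-saturated h (coord x) (coord-periodic x) c k)) (cong (λ j → γˢ j (coord x) k) 1+h+c≡t)

flipAt : ∀ {n} → Fin n → Vec Bool n → Vec Bool n
flipAt a x = updateAt x a not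

flipAt-comm : ∀ {n} (a b : Fin n) x → flipAt a (flipAt b x) ≡ flipAt b (flipAt a x)
flipAt-comm fzero    fzero    (c ∷ x) = refl
flipAt-comm fzero    (fsuc b) (c ∷ x) = refl
flipAt-comm (fsuc a) fzero    (c ∷ x) = refl
flipAt-comm (fsuc a) (fsuc b) (c ∷ x) = cong (c ∷_) (flipAt-comm a b x)

Δ : ∀ {n} → List (Fin n) → (Vec Bool n → Bool) → Vec Bool n → Bool
Δ []      f x = f x
Δ (a ∷ D) f x = Δ D (λ y → f y xor f (flipAt a y)) x

Δ-cong : ∀ {n} D {f g : Vec Bool n → Bool} → (∀ y → f y ≡ g y) → ∀ x → Δ D f x ≡ Δ D g x
Δ-cong []      f≗g x = f≗g x
Δ-cong (a ∷ D) f≗g x = Δ-cong D (λ y → cong₂ _xor_ (f≗g y) (f≗g (flipAt a y))) x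

Δ-false : ∀ {n} D (x : Vec Bool n) → Δ D (λ _ → false) x ≡ false
Δ-false []      x = refl
Δ-false (a ∷ D) x = Δ-false D x

Δ-xor : ∀ {n} D (f g : Vec Bool n → Bool) x → Δ D (λ y → f y xor g y) x ≡ Δ D f x xor Δ D g x
Δ-xor []      f g x = refl
Δ-xor (a ∷ D) f g x = trans (Δ-cong D (λ y → xor-interchange (f y) (g y) (f (flipAt a y)) (g (flipAt a y))) x)
  (Δ-xor D (λ y → f y xor f (flipAt a y)) (λ y → g y xor g (flipAt a y)) x)

Δ-invariant : ∀ {n} {a : Fin n} D (f : Vec Bool n → Bool) → (∀ y → f (flipAt a y) ≡ f y) → a ∈ D →
              ∀ x → Δ D f x ≡ false
Δ-invariant (a ∷ D) f inv (here refl) x =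
  trans (Δ-cong D (λ y → trans (cong (f y xor_) (inv y)) (xor-same (f y))) x) (Δ-false D x)
Δ-invariant {a = a} (b ∷ D) f inv (there a∈D) x = Δ-invariant D (λ y → f y xor f (flipAt b y))
  (λ y → cong₂ _xor_ (inv y) (trans (cong f (flipAt-comm b a y)) (inv (flipAt b y)))) a∈D x

monoEval-flipAt : ∀ {n} (u : Subset n) (a : Fin n) → lookup u a ≡ false → ∀ x → monoEval u (flipAt a x) ≡ monoEval u x
monoEval-flipAt (false ∷ u) fzero    uₐ (c ∷ x) = refl
monoEval-flipAt (b ∷ u)     (fsuc a) uₐ (c ∷ x) = cong ((if b then c else true) ∧_) (monoEval-flipAt u a uₐ x)

∣u∣≡1+∣u-a∣ : ∀ {n} (u : Subset n) (a : Fin n) → lookup u a ≡ true → ∣ u ∣ ≡ suc ∣ u [ a ]≔ false ∣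
∣u∣≡1+∣u-a∣ (true ∷ u)  fzero    uₐ = refl
∣u∣≡1+∣u-a∣ (false ∷ u) (fsuc a) uₐ = ∣u∣≡1+∣u-a∣ u a uₐ
∣u∣≡1+∣u-a∣ (true ∷ u)  (fsuc a) uₐ = cong suc (∣u∣≡1+∣u-a∣ u a uₐ)

pigeonhole : ∀ {n} (u : Subset n) (D : List (Fin n)) → Unique D → ∣ u ∣ < length D → ∃[ a ] a ∈ D × lookup u a ≡ false
pigeonhole u (a ∷ D) (a∉D ∷ D-unique) ∣u∣<∣D∣ with lookup u a in uₐ
... | false = a , here refl , uₐ
... | true with pigeonhole (u [ a ]≔ false) D D-unique
                 (≤-pred (subst (_< suc (length D)) (∣u∣≡1+∣u-a∣ u a uₐ) ∣u∣<∣D∣))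
... | b , b∈D , ub = b , there b∈D , trans (sym (lookup∘updateAt′ b a (b≢a b∈D a∉D) u)) ub
  where
  b≢a : ∀ {b D} → b ∈ D → All (a ≢_) D → b ≢ a
  b≢a (here refl)  (a≢b ∷ _)  b≡a = a≢b (sym b≡a)
  b≢a (there b∈D) (_ ∷ a∉D) b≡a = b≢a b∈D a∉D b≡a

Δ-AnfDegLe : ∀ {n} {f : Vec Bool n → Bool} {e} D → AnfDegLe f e → Unique D → e < length D → ∀ x → Δ D f x ≡ false
Δ-AnfDegLe {f = f} D (p , small , eval) D-unique e<∣D∣ x = trans (Δ-cong D (sym ∘ eval) x) (vanishes p small)
  where
  vanishes : ∀ p → All (λ u → ∣ u ∣ ≤ _) p → Δ D (polyEval p) x ≡ false
  vanishes []      []                 = Δ-false D x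
  vanishes (u ∷ p) (u-small ∷ p-small) with pigeonhole u D D-unique (≤-<-trans u-small e<∣D∣)
  ... | a , a∈D , uₐ = trans (Δ-xor D (monoEval u) (polyEval p) x)
    (cong₂ _xor_ (Δ-invariant D (monoEval u) (monoEval-flipAt u a uₐ) a∈D x) (vanishes p p-small))

¬DegLe : ∀ {n} (g : Vec Bool n → Vec Bool n) i D x → Unique D → Δ D (λ y → lookup (g y) i) x ≡ true →
         ∀ e → e < length D → ¬ DegLe g e
¬DegLe g i D x D-unique Δ≡true e e<∣D∣ g-small with () ← trans (sym Δ≡true) (Δ-AnfDegLe D (g-small i) D-unique e<∣D∣ x)

Δ-∧-literal : ∀ {n} a D (g : Vec Bool n → Bool) s → (∀ y → g (flipAt a y) ≡ g y) →
              ∀ x → Δ (a ∷ D) (λ y → g y ∧ (s xor lookup y a)) x ≡ Δ D g x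
Δ-∧-literal a D g s inv = Δ-cong D λ y → begin
  (g y ∧ (s xor lookup y a)) xor (g (flipAt a y) ∧ (s xor lookup (flipAt a y) a))
    ≡⟨ cong₂ (λ u v → (g y ∧ (s xor lookup y a)) xor (u ∧ (s xor v))) (inv y) (lookup∘updateAt a y) ⟩
  (g y ∧ (s xor lookup y a)) xor (g y ∧ (s xor not (lookup y a)))
    ≡⟨ both-literals (g y) s (lookup y a) ⟩
  g y ∎
  where
  open ≡-Reasoning
  both-literals : ∀ g s c → (g ∧ (s xor c)) xor (g ∧ (s xor not c)) ≡ g
  both-literals false s     c     = refl
  both-literals true  false false = refl
  both-literals true  false true  = refl
  both-literals true  true  false = refl
  both-literals true  true  true  = refl

Δ-combFrom : ∀ {n} D (ψ : Vec Bool n → ℕ → Bool) i B x →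
             Δ D (λ y → combFrom i B (ψ y)) x ≡ combFrom i B (λ t → Δ D (λ y → ψ y t) x)
Δ-combFrom D ψ i []      x = Δ-false D x
Δ-combFrom D ψ i (b ∷ B) x = trans (Δ-xor D (λ y → b ∧ ψ y i) (λ y → combFrom (suc i) B (ψ y)) x)
  (cong₂ _xor_ (scaled b) (Δ-combFrom D ψ (suc i) B x))
  where
  scaled : ∀ b → Δ D (λ y → b ∧ ψ y i) x ≡ b ∧ Δ D (λ y → ψ y i) x
  scaled false = Δ-false D x
  scaled true  = refl

combFrom-suc : ∀ i B φ → combFrom (suc i) B φ ≡ combFrom i B (φ ∘ suc)
combFrom-suc i []      φ = refl
combFrom-suc i (b ∷ B) φ = cong (b ∧ φ (suc i) xor_) (combFrom-suc (suc i) B φ)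

combFrom-vanishes : ∀ i B φ → (∀ t → coeff B t ≡ true → φ (i + t) ≡ false) → combFrom i B φ ≡ false
combFrom-vanishes i []      φ _        = refl
combFrom-vanishes i (b ∷ B) φ vanishes = cong₂ _xor_ (head-term b (vanishes 0))
  (combFrom-vanishes (suc i) B φ λ t bₜ → trans (cong φ (sym (+-suc i t))) (vanishes (suc t) bₜ))
  where
  head-term : ∀ b → (b ≡ true → φ (i + 0) ≡ false) → b ∧ φ i ≡ false
  head-term false _  = refl
  head-term true  φᵢ = trans (cong φ (sym (+-identityʳ i))) (φᵢ refl)

combFrom-single : ∀ B φ J → (∀ t → coeff B t ≡ true → t ≢ J → φ t ≡ false) → combFrom 0 B φ ≡ coeff B J ∧ φ J
combFrom-single []      φ J       _      = refl
combFrom-single (b ∷ B) φ zero    others = trans (cong (b ∧ φ 0 xor_)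
  (combFrom-vanishes 1 B φ λ t bₜ → others (suc t) bₜ λ ())) (xor-identityʳ _)
combFrom-single (b ∷ B) φ (suc J) others = cong₂ _xor_ (head-term b (others 0))
  (trans (combFrom-suc 0 B φ) (combFrom-single B (φ ∘ suc) J λ t bₜ t≢J → others (suc t) bₜ (t≢J ∘ suc-injective)))
  where
  head-term : ∀ b → (b ≡ true → 0 ≢ suc J → φ 0 ≡ false) → b ∧ φ 0 ≡ false
  head-term false _  = refl
  head-term true  φ₀ = φ₀ refl λ ()

toℕ-pos : ∀ {m p} → p < suc m → toℕ (pos {m} p) ≡ p
toℕ-pos {m} {p} p<n = trans (toℕ-fromℕ< (m%n<n p (suc m))) (m<n⇒m%n≡m p<n)

coord-flipAt-other : ∀ {m p q} → p < suc m → q < suc m → q ≢ p → (y : Vec Bool (suc m)) →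
                     coord (flipAt (pos p) y) q ≡ coord y q
coord-flipAt-other {m} {p} {q} p<n q<n q≢p y = trans (coord-pos (flipAt (pos p) y) q)
  (trans (lookup∘updateAt′ (pos q) (pos p) pos-q≢pos-p y) (sym (coord-pos y q)))
  where
  pos-q≢pos-p : pos {m} q ≢ pos p
  pos-q≢pos-p eq = q≢p (trans (sym (toℕ-pos q<n)) (trans (cong toℕ eq) (toℕ-pos p<n)))

2t+1≡2u+1⇒t≡u : ∀ {t u} → 2 * t + 1 ≡ 2 * u + 1 → t ≡ u
2t+1≡2u+1⇒t≡u {t} {u} eq = *-cancelˡ-≡ t u 2 (+-cancelʳ-≡ 1 (2 * t) (2 * u) eq)

2c≢2t+1 : ∀ c t → 2 * c ≢ 2 * t + 1
2c≢2t+1 c t eq = even≢odd c t (trans eq (+-comm (2 * t) 1))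

2t+1<n : ∀ {n t j} → 2 * j ≤ n → t < j → 2 * t + 1 < n
2t+1<n {t = t} 2j≤n t<j = ≤-trans (≤-reflexive (2+2t≡2[1+t] t)) (≤-trans (*-monoʳ-≤ 2 t<j) 2j≤n)
  where
  2+2t≡2[1+t] : ∀ t → suc (2 * t + 1) ≡ 2 * suc t
  2+2t≡2[1+t] = solve-∀

2[1+j]≤n⇒2j≤n : ∀ {n j} → 2 * suc j ≤ n → 2 * j ≤ n
2[1+j]≤n⇒2j≤n {j = j} = ≤-trans (*-monoʳ-≤ 2 (n≤1+n j))

oddZeros-local : ∀ z w k j → (∀ {t} → t < j → z (k + (2 * t + 1)) ≡ w (k + (2 * t + 1))) → oddZeros z k j ≡ oddZeros w k j
oddZeros-local z w k zero    agree = refl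
oddZeros-local z w k (suc j) agree =
  cong₂ (λ u v → u ∧ not v) (oddZeros-local z w k j (λ t<j → agree (m<n⇒m<1+n t<j))) (agree ≤-refl)

oddZeros-flipAt : ∀ {m j p} → 2 * j ≤ suc m → p < suc m → (∀ {t} → t < j → p ≢ 2 * t + 1) →
                  ∀ y → oddZeros (coord (flipAt (pos p) y)) 0 j ≡ oddZeros (coord y) 0 j
oddZeros-flipAt {j = j} 2j≤n p<n p-not-odd y = oddZeros-local _ _ 0 j λ t<j →
  coord-flipAt-other p<n (2t+1<n 2j≤n t<j) (p-not-odd t<j ∘ sym) y

odds : ∀ {m} → ℕ → List (Fin (suc m))
odds zero    = []
odds (suc t) = pos (2 * t + 1) ∷ odds t

length-odds : ∀ {m} j → length (odds {m} j) ≡ j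
length-odds zero    = refl
length-odds (suc j) = cong suc (length-odds j)

odds-∈ : ∀ {m j t} → t < j → pos {m} (2 * t + 1) ∈ odds j
odds-∈ {j = suc j} t<1+j with m<1+n⇒m<n∨m≡n t<1+j
... | inj₁ t<j  = there (odds-∈ t<j)
... | inj₂ refl = here refl

OddBelow : ∀ {m} → ℕ → Fin (suc m) → Set
OddBelow j a = ∃[ t ] t < j × toℕ a ≡ 2 * t + 1

odds-odd : ∀ {m} j → 2 * j ≤ suc m → All (OddBelow j) (odds {m} j)
odds-odd zero    _    = []
odds-odd (suc j) 2j≤n = (j , ≤-refl , toℕ-pos (2t+1<n 2j≤n ≤-refl))
  ∷ All.map (λ { (t , t<j , a≡2t+1) → t , m<n⇒m<1+n t<j , a≡2t+1 }) (odds-odd j (2[1+j]≤n⇒2j≤n 2j≤n))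

odds-unique : ∀ {m} j → 2 * j ≤ suc m → Unique (odds {m} j)
odds-unique zero    _    = []
odds-unique {m} (suc j) 2j≤n = All.map distinct (odds-odd j (2[1+j]≤n⇒2j≤n 2j≤n)) ∷ odds-unique j (2[1+j]≤n⇒2j≤n 2j≤n)
  where
  distinct : ∀ {a} → OddBelow j a → pos (2 * j + 1) ≢ a
  distinct (t , t<j , a≡2t+1) eq =
    <⇒≢ t<j (sym (2t+1≡2u+1⇒t≡u (trans (sym (toℕ-pos (2t+1<n 2j≤n ≤-refl))) (trans (cong toℕ eq) a≡2t+1))))

even∷odds-unique : ∀ {m} c j → 2 * c < suc m → 2 * j ≤ suc m → Unique (pos {m} (2 * c) ∷ odds j)
even∷odds-unique c j 2c<n 2j≤n = All.map distinct (odds-odd j 2j≤n) ∷ odds-unique j 2j≤n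
  where
  distinct : ∀ {a} → OddBelow j a → pos (2 * c) ≢ a
  distinct (t , _ , a≡2t+1) eq = 2c≢2t+1 c t (trans (sym (toℕ-pos 2c<n)) (trans (cong toℕ eq) a≡2t+1))

Δ-oddZeros : ∀ {m} j → 2 * j ≤ suc m → (x : Vec Bool (suc m)) → Δ (odds j) (λ y → oddZeros (coord y) 0 j) x ≡ true
Δ-oddZeros zero    _    x = refl
Δ-oddZeros {m} (suc j) 2j≤n x = begin
  Δ (pos p ∷ odds j) (λ y → oddZeros (coord y) 0 j ∧ not (coord y p)) x
    ≡⟨ Δ-cong (pos p ∷ odds j) (λ y → cong (λ b → oddZeros (coord y) 0 j ∧ not b) (coord-pos y p)) x ⟩
  Δ (pos p ∷ odds j) (λ y → oddZeros (coord y) 0 j ∧ (true xor lookup y (pos p))) x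
    ≡⟨ Δ-∧-literal (pos p) (odds j) (λ y → oddZeros (coord y) 0 j) true (oddZeros-flipAt 2j'≤n p<n p-not-odd) x ⟩
  Δ (odds j) (λ y → oddZeros (coord y) 0 j) x
    ≡⟨ Δ-oddZeros j 2j'≤n x ⟩
  true ∎
  where
  open ≡-Reasoning
  p = 2 * j + 1
  p<n : p < suc m
  p<n = 2t+1<n 2j≤n ≤-refl
  2j'≤n : 2 * j ≤ suc m
  2j'≤n = 2[1+j]≤n⇒2j≤n 2j≤n
  p-not-odd : ∀ {t} → t < j → p ≢ 2 * t + 1
  p-not-odd t<j eq = <⇒≢ t<j (sym (2t+1≡2u+1⇒t≡u eq))

guarded : ∀ {m} → ℕ → ℕ → Vec Bool (suc m) → Bool
guarded e j y = oddZeros (coord y) 0 j ∧ coord y e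

guarded-flipAt : ∀ {m e j p} → e < suc m → 2 * j ≤ suc m → p < suc m → p ≢ e → (∀ {t} → t < j → p ≢ 2 * t + 1) →
                 ∀ y → guarded e j (flipAt (pos p) y) ≡ guarded e j y
guarded-flipAt e<n 2j≤n p<n p≢e p-not-odd y =
  cong₂ _∧_ (oddZeros-flipAt 2j≤n p<n p-not-odd y) (coord-flipAt-other p<n e<n (p≢e ∘ sym) y)

Δ-guarded : ∀ {m e j} → e < suc m → 2 * j ≤ suc m → (∀ {t} → t < j → e ≢ 2 * t + 1) →
            ∀ x → Δ (pos e ∷ odds j) (guarded e j) x ≡ true
Δ-guarded {e = e} {j} e<n 2j≤n e-not-odd x = begin
  Δ (pos e ∷ odds j) (guarded e j) x
    ≡⟨ Δ-cong (pos e ∷ odds j) (λ y → cong (oddZeros (coord y) 0 j ∧_) (coord-pos y e)) x ⟩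
  Δ (pos e ∷ odds j) (λ y → oddZeros (coord y) 0 j ∧ (false xor lookup y (pos e))) x
    ≡⟨ Δ-∧-literal (pos e) (odds j) (λ y → oddZeros (coord y) 0 j) false (oddZeros-flipAt 2j≤n e<n e-not-odd) x ⟩
  Δ (odds j) (λ y → oddZeros (coord y) 0 j) x
    ≡⟨ Δ-oddZeros j 2j≤n x ⟩
  true ∎
  where open ≡-Reasoning

γˢ-guarded : ∀ {m} j (y : Vec Bool (suc m)) → γˢ j (coord y) 0 ≡ guarded (2 * j) j y
γˢ-guarded j y = trans (γˢ-form j (coord y) 0) (∧-comm (coord y (2 * j)) _)

γˢ-guarded-even : ∀ h c (y : Vec Bool (suc h + suc h)) → γˢ (suc h + c) (coord y) 0 ≡ guarded (2 * c) (suc h) y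
γˢ-guarded-even h c y = trans (γˢ-saturated h (coord y) (coord-periodic y) c 0) (∧-comm (coord y (2 * c)) _)

Δ-applyPoly : ∀ {m} D B J (x : Vec Bool (suc m)) →
  (∀ t → coeff B t ≡ true → t ≢ J → Δ D (λ y → γˢ t (coord y) 0) x ≡ false) →
  Δ D (λ y → lookup (applyPoly B y) fzero) x ≡ coeff B J ∧ Δ D (λ y → γˢ J (coord y) 0) x
Δ-applyPoly D B J x others = begin
  Δ D (λ y → lookup (applyPoly B y) fzero) x
    ≡⟨ Δ-cong D (λ y → trans (lookup-coord (applyPoly B y) fzero) (coord-applyPolyFrom y 0 B 0)) x ⟩
  Δ D (λ y → combFrom 0 B (λ t → γˢ t (coord y) 0)) x
    ≡⟨ Δ-combFrom D (λ y t → γˢ t (coord y) 0) 0 B x ⟩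
  combFrom 0 B (λ t → Δ D (λ y → γˢ t (coord y) 0) x)
    ≡⟨ combFrom-single B (λ t → Δ D (λ y → γˢ t (coord y) 0) x) J others ⟩
  coeff B J ∧ Δ D (λ y → γˢ J (coord y) 0) x ∎
  where open ≡-Reasoning

applyPoly-¬DegLe : ∀ {m} B J (D : List (Fin (suc m))) → Unique D → coeff B J ≡ true →
  (∀ x → Δ D (λ y → γˢ J (coord y) 0) x ≡ true) →
  (∀ t → coeff B t ≡ true → t ≢ J → ∀ x → Δ D (λ y → γˢ t (coord y) 0) x ≡ false) →
  ∀ e → e < length D → ¬ DegLe (applyPoly {suc m} B) e
applyPoly-¬DegLe B J D D-unique b_J Δγ_J others = ¬DegLe (applyPoly B) fzero D 𝟘 D-unique
  (trans (Δ-applyPoly D B J 𝟘 (λ t bₜ t≢J → others t bₜ t≢J 𝟘)) (cong₂ _∧_ b_J (Δγ_J 𝟘)))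

Δ-guarded-vanishes : ∀ {m e j p} D → e < suc m → 2 * j ≤ suc m → p < suc m → p ≢ e →
                     (∀ {u} → u < j → p ≢ 2 * u + 1) → pos p ∈ D → ∀ x → Δ D (guarded e j) x ≡ false
Δ-guarded-vanishes D e<n 2j≤n p<n p≢e p-not-odd p∈D =
  Δ-invariant D _ (guarded-flipAt e<n 2j≤n p<n p≢e p-not-odd) p∈D

HasAlgDeg-applyPoly : ∀ {m} B J → HasDegree B J → 2 * J < suc m → HasAlgDeg (applyPoly {suc m} B) (suc J)
HasAlgDeg-applyPoly {m} B J (b_J , below) 2J<n = DegLe-applyPoly-≤ B J below , λ e e<1+J →
  applyPoly-¬DegLe B J D (even∷odds-unique J J 2J<n (<⇒≤ 2J<n)) b_J
    (λ x → trans (Δ-cong D (γˢ-guarded J) x) (Δ-guarded {j = J} 2J<n (<⇒≤ 2J<n) (λ {t} _ → 2c≢2t+1 J t) x))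
    others e (subst (e <_) (cong suc (sym (length-odds J))) e<1+J)
  where
  D = pos (2 * J) ∷ odds J
  others : ∀ t → coeff B t ≡ true → t ≢ J → ∀ x → Δ D (λ y → γˢ t (coord y) 0) x ≡ false
  others t bₜ t≢J x = trans (Δ-cong D (γˢ-guarded t) x)
    (Δ-guarded-vanishes {j = t} D 2t<n (<⇒≤ 2t<n) 2J<n (t≢J ∘ sym ∘ *-cancelˡ-≡ J t 2) (λ {u} _ → 2c≢2t+1 J u)
      (here refl) x)
    where
    2t<n : 2 * t < suc m
    2t<n = ≤-<-trans (*-monoʳ-≤ 2 (≤-pred (DegBelow⇒< below bₜ))) 2J<n

HasAlgDeg-applyPoly-even : ∀ h B c → c < suc h → coeff B (suc h + c) ≡ true → DegBelow B (suc h + suc h) →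
                           HasAlgDeg (applyPoly {suc h + suc h} B) (suc (suc h))
HasAlgDeg-applyPoly-even h B c c<H b_H+c below = DegLe-applyPoly-even h B , λ e e<2+h →
  applyPoly-¬DegLe B (H + c) D (even∷odds-unique c H (2c<n c<H) 2H≤n) b_H+c
    (λ x → trans (Δ-cong D (γˢ-guarded-even h c) x) (Δ-guarded {j = H} (2c<n c<H) 2H≤n (λ {t} _ → 2c≢2t+1 c t) x))
    others e (subst (e <_) (cong suc (sym (length-odds H))) e<2+h)
  where
  H = suc h
  D = pos (2 * c) ∷ odds H
  2H≤n : 2 * H ≤ H + H
  2H≤n = ≤-reflexive (cong (H +_) (+-identityʳ H))
  2c<n : ∀ {c} → c < H → 2 * c < H + H
  2c<n c<H = <-≤-trans (*-monoʳ-< 2 c<H) 2H≤n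
  others : ∀ t → coeff B t ≡ true → t ≢ H + c → ∀ x → Δ D (λ y → γˢ t (coord y) 0) x ≡ false
  others t bₜ t≢H+c x with t <? H
  ... | yes t<H = trans (Δ-cong D (γˢ-guarded t) x)
    (Δ-guarded-vanishes {j = t} D (2c<n t<H) (<⇒≤ (2c<n t<H)) (2t+1<n 2H≤n ≤-refl) (2c≢2t+1 t h ∘ sym)
      (λ u<t 2h+1≡2u+1 → <⇒≢ (<-≤-trans u<t (≤-pred t<H)) (sym (2t+1≡2u+1⇒t≡u 2h+1≡2u+1)))
      (there (odds-∈ ≤-refl)) x)
  ... | no  t≮H = trans (Δ-cong D (λ y → trans (cong (λ j → γˢ j (coord y) 0) (sym H+c'≡t)) (γˢ-guarded-even h c' y)) x)
    (Δ-guarded-vanishes {j = H} D (2c<n c'<H) 2H≤n (2c<n c<H) (t≢H+c ∘ t≡H+c ∘ *-cancelˡ-≡ c c' 2)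
      (λ {u} _ → 2c≢2t+1 c u) (here refl) x)
    where
    c' = t ∸ H
    H+c'≡t : H + c' ≡ t
    H+c'≡t = m+[n∸m]≡n (≮⇒≥ t≮H)
    c'<H : c' < H
    c'<H = +-cancelˡ-< H c' H (subst (_< H + H) (sym H+c'≡t) (DegBelow⇒< below bₜ))
    t≡H+c : c ≡ c' → t ≡ H + c
    t≡H+c c≡c' = trans (sym H+c'≡t) (cong (H +_) (sym c≡c'))

-- κ is not injective when 6 ∣ n

p6 : Seq
p6 0 = false
p6 1 = false
p6 2 = false
p6 3 = true
p6 4 = false
p6 5 = true
p6 (suc (suc (suc (suc (suc (suc k)))))) = p6 k

p6-periodic : Periodic 6 p6
p6-periodic 0 = refl
p6-periodic 1 = refl
p6-periodic 2 = refl
p6-periodic 3 = refl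
p6-periodic 4 = refl
p6-periodic 5 = refl
p6-periodic (suc (suc (suc (suc (suc (suc k)))))) = p6-periodic k

κ-kills-p6 : ∀ k → applyPolyˢ oneXX p6 k ≡ false
κ-kills-p6 0 = refl
κ-kills-p6 1 = refl
κ-kills-p6 2 = refl
κ-kills-p6 3 = refl
κ-kills-p6 4 = refl
κ-kills-p6 5 = refl
κ-kills-p6 (suc (suc (suc (suc (suc (suc k)))))) = κ-kills-p6 k

combFrom-cong : ∀ i B {φ ψ} → (∀ t → φ t ≡ ψ t) → combFrom i B φ ≡ combFrom i B ψ
combFrom-cong i []      φ≗ψ = refl
combFrom-cong i (b ∷ B) φ≗ψ = cong₂ _xor_ (cong (b ∧_) (φ≗ψ i)) (combFrom-cong (suc i) B φ≗ψ)

applyPolyˢ-cong : ∀ {z w} → (∀ k → z k ≡ w k) → ∀ B k → applyPolyˢ B z k ≡ applyPolyˢ B w k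
applyPolyˢ-cong {z} {w} z≗w B k = combFrom-cong 0 B γˢ-cong
  where
  γˢ-cong : ∀ j → γˢ j z k ≡ γˢ j w k
  γˢ-cong zero    = z≗w k
  γˢ-cong (suc j) = cong₂ _∧_ (z≗w _) (oddZeros-local z w k (suc j) (λ _ → z≗w _))

coord-p6 : ∀ {m} → 6 ∣ suc m → ∀ k → coord (tabulate {n = suc m} (p6 ∘ toℕ)) k ≡ p6 k
coord-p6 {m} (divides q n≡q*6) k = begin
  coord x k                              ≡⟨ coord-pos x k ⟩
  lookup x (pos k)                       ≡⟨ lookup∘tabulate (p6 ∘ toℕ) (pos k) ⟩
  p6 (toℕ (pos {m} k))                   ≡⟨ cong p6 (toℕ-fromℕ< (m%n<n k (suc m))) ⟩
  p6 (k % suc m)                         ≡⟨ Periodic-* p6-n-periodic (k / suc m) (k % suc m) ⟨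
  p6 (k % suc m + k / suc m * suc m)     ≡⟨ cong p6 (m≡m%n+[m/n]*n k (suc m)) ⟨
  p6 k                                   ∎
  where
  open ≡-Reasoning
  x = tabulate (p6 ∘ toℕ)
  p6-n-periodic : Periodic (suc m) p6
  p6-n-periodic = subst (λ n → Periodic n p6) (sym n≡q*6) (Periodic-* p6-periodic q)

κ-vanishes : ∀ {m} (y : Vec Bool (suc m)) → (∀ k → applyPolyˢ oneXX (coord y) k ≡ false) → κ y ≡ 𝟘
κ-vanishes y vanishes = coord-ext λ k → begin
  coord (κ y) k                     ≡⟨ cong (λ v → coord v k) (κ≡applyPoly-oneXX y) ⟩
  coord (applyPoly oneXX y) k       ≡⟨ coord-applyPolyFrom y 0 oneXX k ⟩
  applyPolyˢ oneXX (coord y) k      ≡⟨ vanishes k ⟩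
  false                             ≡⟨ coord-replicate false k ⟨
  coord 𝟘 k                         ∎
  where open ≡-Reasoning

κ-not-injective : ∀ {m} → 6 ∣ suc m → ¬ Injective _≡_ _≡_ (κ {suc m})
κ-not-injective {m} 6∣n inj = contradiction x₃≡𝟘₃ λ ()
  where
  open ≡-Reasoning
  x = tabulate (p6 ∘ toℕ)
  κx≡𝟘 : κ x ≡ 𝟘
  κx≡𝟘 = κ-vanishes x λ k → trans (applyPolyˢ-cong (coord-p6 6∣n) oneXX k) (κ-kills-p6 k)
  κ𝟘≡𝟘 : κ {suc m} 𝟘 ≡ 𝟘
  κ𝟘≡𝟘 = κ-vanishes 𝟘 λ k → applyPolyˢ-cong (coord-replicate false) oneXX k
  x₃≡𝟘₃ : true ≡ false
  x₃≡𝟘₃ = begin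
    true      ≡⟨ coord-p6 6∣n 3 ⟨
    coord x 3 ≡⟨ cong (λ v → coord v 3) (inj (trans κx≡𝟘 (sym κ𝟘≡𝟘))) ⟩
    coord (𝟘 {suc m}) 3 ≡⟨ coord-replicate {m} false 3 ⟩
    false     ∎

data Residue6 : ℕ → Set where
  6q+0 : ∀ q → Residue6 (6 * q + 0)
  6q+1 : ∀ q → Residue6 (6 * q + 1)
  6q+2 : ∀ q → Residue6 (6 * q + 2)
  6q+3 : ∀ q → Residue6 (6 * q + 3)
  6q+4 : ∀ q → Residue6 (6 * q + 4)
  6q+5 : ∀ q → Residue6 (6 * q + 5)

6[n/6]+n%6≡n : ∀ n → 6 * (n / 6) + n % 6 ≡ n
6[n/6]+n%6≡n n = trans (+-comm (6 * (n / 6)) (n % 6))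
  (trans (cong (n % 6 +_) (*-comm 6 (n / 6))) (sym (m≡m%n+[m/n]*n n 6)))

residue6 : ∀ n → Residue6 n
residue6 n with n % 6 | m%n<n n 6 | 6[n/6]+n%6≡n n
... | 0 | _ | n≡ = subst Residue6 n≡ (6q+0 (n / 6))
... | 1 | _ | n≡ = subst Residue6 n≡ (6q+1 (n / 6))
... | 2 | _ | n≡ = subst Residue6 n≡ (6q+2 (n / 6))
... | 3 | _ | n≡ = subst Residue6 n≡ (6q+3 (n / 6))
... | 4 | _ | n≡ = subst Residue6 n≡ (6q+4 (n / 6))
... | 5 | _ | n≡ = subst Residue6 n≡ (6q+5 (n / 6))
... | suc (suc (suc (suc (suc (suc _))))) | s≤s (s≤s (s≤s (s≤s (s≤s (s≤s ()))))) | _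

[6q+r]%6≡r : ∀ q r → r < 6 → (6 * q + r) % 6 ≡ r
[6q+r]%6≡r q r r<6 = trans (cong (_% 6) (trans (+-comm (6 * q) r) (cong (r +_) (*-comm 6 q))))
  (trans ([m+kn]%n≡m%n r q 6) (m<n⇒m%n≡m r<6))

half : ∀ {a b} → b ≡ a * 2 → b / 2 ≡ a
half {a} b≡2a = trans (cong (_/ 2) b≡2a) (m*n/n≡m a 2)

dval-6q+r : ∀ q r → r < 6 → dval (6 * q + r) ≡ dvalR (6 * q + r) r
dval-6q+r q r r<6 = cong (dvalR _) ([6q+r]%6≡r q r r<6)

dval-6q+1 : ∀ q → dval (6 * q + 1) ≡ suc (3 * q)
dval-6q+1 q = trans (dval-6q+r q 1 (s≤s (m≤m+n 1 4))) (half (arith q))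
  where
  arith : ∀ q → 6 * q + 1 + 1 ≡ suc (3 * q) * 2
  arith = solve-∀

dval-6q+2 : ∀ q → dval (6 * q + 2) ≡ suc (suc (3 * q))
dval-6q+2 q = trans (dval-6q+r q 2 (s≤s (m≤m+n 2 3))) (trans (cong (_+ 1) (half (arith q))) (+-comm _ 1))
  where
  arith : ∀ q → 6 * q + 2 ≡ suc (3 * q) * 2
  arith = solve-∀

dval-6q+3 : ∀ q → dval (6 * q + 3) ≡ suc (suc (3 * q))
dval-6q+3 q = trans (dval-6q+r q 3 (s≤s (m≤m+n 3 2))) (half (arith q))
  where
  arith : ∀ q → 6 * q + 3 + 1 ≡ suc (suc (3 * q)) * 2
  arith = solve-∀

dval-6q+4 : ∀ q → dval (6 * q + 4) ≡ suc (suc (3 * q + 1))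
dval-6q+4 q = trans (dval-6q+r q 4 (s≤s (m≤m+n 4 1))) (trans (cong (_+ 1) (half (arith q))) (+-comm _ 1))
  where
  arith : ∀ q → 6 * q + 4 ≡ suc (3 * q + 1) * 2
  arith = solve-∀

dval-6q+5 : ∀ q → dval (6 * q + 5) ≡ suc (suc (3 * q))
dval-6q+5 q = trans (dval-6q+r q 5 (s≤s (m≤m+n 5 0))) (half (trans (cong (_∸ 1) (+-suc (6 * q) 4)) (arith q)))
  where
  arith : ∀ q → 6 * q + 4 ≡ suc (suc (3 * q)) * 2
  arith = solve-∀

InverseMod : ℕ → Poly → Poly → Set
InverseMod n M B = InvOfκ n B × CongMod M (oneXX *P B) oneP

CongMod-from-≋ : ∀ {M} p c → (p +P c) ≋ M → CongMod M p c
CongMod-from-≋ {M} p c p+c≋M = oneP , coeffwise (≋-trans p+c≋M (≋-sym (*P-identityˡ M)))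

P3-inverse : ∀ h k → suc h ≤ 3 * k → InverseMod (suc (2 * h)) (X^ (suc h)) (P3 k)
P3-inverse h (suc k) h<3k = InvOfκ-odd h (P3 (suc k)) (P3-const k) congruence , congruence
  where
  congruence = oneXX*P3-congruence (suc k) (suc h) h<3k

P3+X^-inverse : ∀ q → InverseMod (suc (2 * (3 * q))) (X^ (suc (3 * q))) (P3 (suc q) +P X^ (suc (3 * q)))
P3+X^-inverse q = InvOfκ-odd (3 * q) (P3 (suc q) +P X^ (suc (3 * q)))
  (trans (coeff-+P (P3 (suc q)) (X^ (suc (3 * q))) 0) (cong (_xor false) (P3-const q))) congruence , congruence
  where
  congruence = oneXX*[P3+X^]-congruence (suc q) (suc (3 * q)) (sym (*-suc 3 q))

B-6k+2 : ℕ → Poly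
B-6k+2 k = oneP +P ((Xp *P P3 k) +P (X^ 2 *P P3 (2 * k)))

B-6k+4 : ℕ → Poly
B-6k+4 k = oneP +P ((X^ 2 *P P3 k) +P (Xp *P P3 (2 * k + 1)))

B-6k+2-inverse : ∀ n k → n ≡ 6 * k + 2 → InverseMod n (X^ n +P X^ (n / 2)) (B-6k+2 k)
B-6k+2-inverse .(6 * k + 2) k refl = fit (arith₁ k) n/2≡H congruence , congruence
  where
  arith₁ : ∀ k → 6 * k + 2 ≡ suc (3 * k) + suc (3 * k)
  arith₁ = solve-∀
  arith₂ : ∀ k → 6 * k + 2 ≡ suc (3 * k) * 2
  arith₂ = solve-∀
  arith₃ : ∀ k → 2 + 3 * (2 * k) ≡ 6 * k + 2
  arith₃ = solve-∀
  n/2≡H : (6 * k + 2) / 2 ≡ suc (3 * k)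
  n/2≡H = half (arith₂ k)
  congruence : CongMod (X^ (6 * k + 2) +P X^ ((6 * k + 2) / 2)) (oneXX *P B-6k+2 k) oneP
  congruence = CongMod-from-≋ (oneXX *P B-6k+2 k) oneP (≋-trans (oneXX*[1+X^P3+X^P3] 1 2 k (2 * k) ≋-refl)
    (≋-trans (+P-comm (X^ (1 + 3 * k)) (X^ (2 + 3 * (2 * k))))
      (≋-reflexive (cong₂ (λ a b → X^ a +P X^ b) (arith₃ k) (sym n/2≡H)))))
  fit : ∀ {n m} → n ≡ suc (3 * k) + suc (3 * k) → m ≡ suc (3 * k) →
        CongMod (X^ n +P X^ m) (oneXX *P B-6k+2 k) oneP → InvOfκ n (B-6k+2 k)
  fit refl refl = InvOfκ-even (3 * k) (B-6k+2 k) refl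

B-6k+4-inverse : ∀ n k → n ≡ 6 * k + 4 → InverseMod n (X^ n +P X^ (n / 2)) (B-6k+4 k)
B-6k+4-inverse .(6 * k + 4) k refl = fit (arith₁ k) n/2≡H congruence , congruence
  where
  arith₁ : ∀ k → 6 * k + 4 ≡ suc (3 * k + 1) + suc (3 * k + 1)
  arith₁ = solve-∀
  arith₂ : ∀ k → 6 * k + 4 ≡ suc (3 * k + 1) * 2
  arith₂ = solve-∀
  arith₃ : ∀ k → 1 + 3 * (2 * k + 1) ≡ 6 * k + 4
  arith₃ = solve-∀
  arith₄ : ∀ k → 2 + 3 * k ≡ suc (3 * k + 1)
  arith₄ = solve-∀
  n/2≡H : (6 * k + 4) / 2 ≡ suc (3 * k + 1)
  n/2≡H = half (arith₂ k)
  congruence : CongMod (X^ (6 * k + 4) +P X^ ((6 * k + 4) / 2)) (oneXX *P B-6k+4 k) oneP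
  congruence = CongMod-from-≋ (oneXX *P B-6k+4 k) oneP (≋-trans (oneXX*[1+X^P3+X^P3] 2 1 k (2 * k + 1) (+P-comm (X^ 2) Xp))
    (≋-trans (+P-comm (X^ (2 + 3 * k)) (X^ (1 + 3 * (2 * k + 1))))
      (≋-reflexive (cong₂ (λ a b → X^ a +P X^ b) (arith₃ k) (trans (arith₄ k) (sym n/2≡H))))))
  fit : ∀ {n m} → n ≡ suc (3 * k + 1) + suc (3 * k + 1) → m ≡ suc (3 * k + 1) →
        CongMod (X^ n +P X^ m) (oneXX *P B-6k+4 k) oneP → InvOfκ n (B-6k+4 k)
  fit refl refl = InvOfκ-even (3 * k + 1) (B-6k+4 k) refl

HasDegree-≋ : ∀ {p q J} → p ≋ q → HasDegree p J → HasDegree q J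
HasDegree-≋ {J = J} p≋q (top , below) = trans (sym (coeffwise p≋q J)) top , DegBelow-≋ p≋q below

P3+X^-HasDegree : ∀ q → HasDegree (P3 (suc q) +P X^ (suc (3 * q))) (3 * q)
P3+X^-HasDegree q = HasDegree-≋ (≋-sym equal) (top , below)
  where
  e = 3 * q
  equal : (P3 (suc q) +P X^ (suc e)) ≋ (P3 q +P X^ e)
  equal = begin
    P3 (suc q) +P X^ (suc e)                               ≈⟨ +P-congʳ (X^ (suc e)) (P3-suc q) ⟩
    (P3 q +P (X^ e +P X^ (suc e))) +P X^ (suc e)           ≈⟨ +P-assoc (P3 q) _ (X^ (suc e)) ⟩
    P3 q +P ((X^ e +P X^ (suc e)) +P X^ (suc e))           ≈⟨ +P-congˡ (P3 q) (+P-assoc (X^ e) _ (X^ (suc e))) ⟩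
    P3 q +P (X^ e +P (X^ (suc e) +P X^ (suc e)))           ≈⟨ +P-congˡ (P3 q) (+P-congˡ (X^ e) (+P-self (X^ (suc e)))) ⟩
    P3 q +P (X^ e +P [])                                   ≈⟨ +P-congˡ (P3 q) (+P-identityʳ (X^ e)) ⟩
    P3 q +P X^ e                                           ∎
    where open SetoidReasoning ≋-setoid
  top : coeff (P3 q +P X^ e) e ≡ true
  top = trans (coeff-+P (P3 q) (X^ e) e) (cong₂ _xor_ (vanishes-from (P3-degBelow q) e ≤-refl) (coeff-X^-same e))
  below : DegBelow (P3 q +P X^ e) (suc e)
  below = DegBelow-+P (DegBelow-mono (n≤1+n e) (P3-degBelow q)) (DegBelow-X^ e)

coeff-oneP+ : ∀ p i → coeff (oneP +P p) (suc i) ≡ coeff p (suc i)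
coeff-oneP+ []      i = refl
coeff-oneP+ (a ∷ p) i = refl

B-6k+2-HasAlgDeg : ∀ q → let H = suc (3 * suc q) in
                         HasAlgDeg (applyPoly {H + H} (B-6k+2 (suc q))) (suc H)
B-6k+2-HasAlgDeg q = HasAlgDeg-applyPoly-even (3 * k) (B-6k+2 k) c c<H coefficient bound
  where
  k = suc q
  H = suc (3 * k)
  c = 3 * q + 2
  A = Xp *P P3 k
  C = X^ 2 *P P3 (2 * k)
  arith₁ : ∀ q → suc (suc (3 * q + 2)) ≡ suc (3 * suc q)
  arith₁ = solve-∀
  c<H : c < H
  c<H = ≤-trans (n≤1+n _) (≤-reflexive (arith₁ q))
  arith₂ : ∀ q → suc (3 * suc q) + (3 * q + 2) ≡ 2 + suc (3 * (2 * q + 1))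
  arith₂ = solve-∀
  arith₃ : ∀ q → 2 * suc q ≡ suc (2 * q + 1)
  arith₃ = solve-∀
  arith₄ : ∀ q → 2 + 3 * (2 * suc q) ≡ suc (3 * suc q) + suc (3 * suc q)
  arith₄ = solve-∀
  C-top : coeff C (H + c) ≡ true
  C-top = begin
    coeff C (H + c)                                    ≡⟨ cong (coeff C) (arith₂ q) ⟩
    coeff C (2 + suc (3 * (2 * q + 1)))                ≡⟨ coeff-X^*P 2 (P3 (2 * k)) _ ⟩
    coeff (P3 (2 * k)) (suc (3 * (2 * q + 1)))         ≡⟨ cong (λ j → coeff (P3 j) (suc (3 * (2 * q + 1)))) (arith₃ q) ⟩
    coeff (P3 (suc (2 * q + 1))) (suc (3 * (2 * q + 1))) ≡⟨ proj₁ (P3-top (2 * q + 1)) ⟩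
    true                                               ∎
    where open ≡-Reasoning
  coefficient : coeff (B-6k+2 k) (H + c) ≡ true
  coefficient = trans (coeff-oneP+ (A +P C) (3 * k + c)) (trans (coeff-+P A C (H + c))
    (cong₂ _xor_ (vanishes-from (DegBelow-X^*P 1 (P3-degBelow k)) (H + c) (m≤m+n H c)) C-top))
  bound : DegBelow (B-6k+2 k) (H + H)
  bound = DegBelow-+P (DegBelow-mono (s≤s z≤n) (DegBelow-X^ 0))
    (DegBelow-+P (DegBelow-mono (m≤m+n H H) (DegBelow-X^*P 1 (P3-degBelow k)))
                 (DegBelow-mono (≤-reflexive (arith₄ q)) (DegBelow-X^*P 2 (P3-degBelow (2 * k)))))

B-6k+4-HasAlgDeg : ∀ q → let H = suc (3 * q + 1) in
                         HasAlgDeg (applyPoly {H + H} (B-6k+4 q)) (suc H)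
B-6k+4-HasAlgDeg q = HasAlgDeg-applyPoly-even (3 * q + 1) (B-6k+4 q) (3 * q) c<H coefficient bound
  where
  H = suc (3 * q + 1)
  c = 3 * q
  A = X^ 2 *P P3 q
  C = Xp *P P3 (2 * q + 1)
  c<H : c < H
  c<H = s≤s (m≤m+n c 1)
  arith₁ : ∀ q → 2 + 3 * q ≡ suc (3 * q + 1)
  arith₁ = solve-∀
  arith₂ : ∀ q → suc (3 * q + 1) + 3 * q ≡ 1 + suc (3 * (2 * q))
  arith₂ = solve-∀
  arith₃ : ∀ q → 1 + 3 * (2 * q + 1) ≡ suc (3 * q + 1) + suc (3 * q + 1)
  arith₃ = solve-∀
  C-top : coeff C (H + c) ≡ true
  C-top = begin
    coeff C (H + c)                                 ≡⟨ cong (coeff C) (arith₂ q) ⟩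
    coeff C (1 + suc (3 * (2 * q)))                 ≡⟨ coeff-X^*P 1 (P3 (2 * q + 1)) _ ⟩
    coeff (P3 (2 * q + 1)) (suc (3 * (2 * q)))      ≡⟨ cong (λ j → coeff (P3 j) (suc (3 * (2 * q)))) (+-comm (2 * q) 1) ⟩
    coeff (P3 (suc (2 * q))) (suc (3 * (2 * q)))    ≡⟨ proj₁ (P3-top (2 * q)) ⟩
    true                                            ∎
    where open ≡-Reasoning
  A-below : DegBelow A H
  A-below = subst (DegBelow A) (arith₁ q) (DegBelow-X^*P 2 (P3-degBelow q))
  coefficient : coeff (B-6k+4 q) (H + c) ≡ true
  coefficient = trans (coeff-oneP+ (A +P C) (3 * q + 1 + c)) (trans (coeff-+P A C (H + c))
    (cong₂ _xor_ (vanishes-from A-below (H + c) (m≤m+n H c)) C-top))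
  bound : DegBelow (B-6k+4 q) (H + H)
  bound = DegBelow-+P (DegBelow-mono (s≤s z≤n) (DegBelow-X^ 0))
    (DegBelow-+P (DegBelow-mono (m≤m+n H H) A-below)
                 (subst (DegBelow C) (arith₃ q) (DegBelow-X^*P 1 (P3-degBelow (2 * q + 1)))))

InverseOfDegree : ℕ → Set
InverseOfDegree n = ∃[ B ] InvOfκ n B × HasAlgDeg (applyPoly {n} B) (dval n)

mkInverseOfDegree : ∀ {n₁ n₂ n d} B → n₁ ≡ n → n₂ ≡ n → dval n ≡ d →
                  InvOfκ n₁ B → HasAlgDeg (applyPoly {n₂} B) d → InverseOfDegree n
mkInverseOfDegree B refl refl refl inverse degree = B , inverse , degree

inverseOfDegree-6q+1 : ∀ q → InverseOfDegree (6 * q + 1)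
inverseOfDegree-6q+1 q = mkInverseOfDegree (P3 (suc q) +P X^ (suc (3 * q))) (n≡ q) (n≡ q) (dval-6q+1 q)
  (proj₁ (P3+X^-inverse q)) (HasAlgDeg-applyPoly (P3 (suc q) +P X^ (suc (3 * q))) (3 * q) (P3+X^-HasDegree q) ≤-refl)
  where
  n≡ : ∀ q → suc (2 * (3 * q)) ≡ 6 * q + 1
  n≡ = solve-∀

inverseOfDegree-6q+2 : ∀ q → InverseOfDegree (6 * suc q + 2)
inverseOfDegree-6q+2 q = mkInverseOfDegree (B-6k+2 (suc q)) refl (n≡ q) (dval-6q+2 (suc q))
  (proj₁ (B-6k+2-inverse _ (suc q) refl)) (B-6k+2-HasAlgDeg q)
  where
  n≡ : ∀ q → suc (3 * suc q) + suc (3 * suc q) ≡ 6 * suc q + 2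
  n≡ = solve-∀

inverseOfDegree-6q+3 : ∀ q → InverseOfDegree (6 * q + 3)
inverseOfDegree-6q+3 q = mkInverseOfDegree (P3 (suc q)) (n≡ q) (n≡ q) (dval-6q+3 q)
  (proj₁ (P3-inverse (3 * q + 1) (suc q) (≤-trans (n≤1+n _) (≤-reflexive (h≡ q)))))
  (HasAlgDeg-applyPoly (P3 (suc q)) (suc (3 * q)) (P3-top q) (≤-reflexive (2J<n q)))
  where
  n≡ : ∀ q → suc (2 * (3 * q + 1)) ≡ 6 * q + 3
  n≡ = solve-∀
  h≡ : ∀ q → suc (suc (3 * q + 1)) ≡ 3 * suc q
  h≡ = solve-∀
  2J<n : ∀ q → suc (2 * suc (3 * q)) ≡ suc (2 * (3 * q + 1))
  2J<n = solve-∀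

inverseOfDegree-6q+4 : ∀ q → InverseOfDegree (6 * q + 4)
inverseOfDegree-6q+4 q = mkInverseOfDegree (B-6k+4 q) refl (n≡ q) (dval-6q+4 q)
  (proj₁ (B-6k+4-inverse _ q refl)) (B-6k+4-HasAlgDeg q)
  where
  n≡ : ∀ q → suc (3 * q + 1) + suc (3 * q + 1) ≡ 6 * q + 4
  n≡ = solve-∀

inverseOfDegree-6q+5 : ∀ q → InverseOfDegree (6 * q + 5)
inverseOfDegree-6q+5 q = mkInverseOfDegree (P3 (suc q)) (n≡ q) (n≡ q) (dval-6q+5 q)
  (proj₁ (P3-inverse (3 * q + 2) (suc q) (≤-reflexive (h≡ q))))
  (HasAlgDeg-applyPoly (P3 (suc q)) (suc (3 * q)) (P3-top q) (≤-trans (m≤m+n _ 2) (≤-reflexive (2J+3≡n q))))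
  where
  n≡ : ∀ q → suc (2 * (3 * q + 2)) ≡ 6 * q + 5
  n≡ = solve-∀
  h≡ : ∀ q → suc (3 * q + 2) ≡ 3 * suc q
  h≡ = solve-∀
  2J+3≡n : ∀ q → suc (2 * suc (3 * q)) + 2 ≡ suc (2 * (3 * q + 2))
  2J+3≡n = solve-∀

inverseOfDegree : ∀ n → 4 ≤ n → ¬ 6 ∣ n → InverseOfDegree n
inverseOfDegree n 4≤n 6∤n with residue6 n
... | 6q+0 q       = contradiction (divides q (trans (+-identityʳ (6 * q)) (*-comm 6 q))) 6∤n
... | 6q+1 q       = inverseOfDegree-6q+1 q
... | 6q+2 zero    = contradiction 4≤n λ { (s≤s (s≤s ())) }
... | 6q+2 (suc q) = inverseOfDegree-6q+2 q
... | 6q+3 q       = inverseOfDegree-6q+3 q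
... | 6q+4 q       = inverseOfDegree-6q+4 q
... | 6q+5 q       = inverseOfDegree-6q+5 q

InvOfκ⇒Bijective : ∀ {n} B → InvOfκ n B → Bijective _≡_ _≡_ (κ {n})
InvOfκ⇒Bijective B inverse =
  (λ {x} {y} κx≡κy → trans (sym (proj₁ (inverse x))) (trans (cong (applyPoly B) κx≡κy) (proj₁ (inverse y)))) ,
  (λ y → applyPoly B y , λ z≡B[y] → trans (cong κ z≡B[y]) (proj₂ (inverse y)))

HasAlgDeg-cong : ∀ {n} {f g : Vec Bool n → Vec Bool n} {d} → (∀ x → f x ≡ g x) → HasAlgDeg f d → HasAlgDeg g d
HasAlgDeg-cong f≗g (f-small , f-not-smaller) =
  (λ i → AnfDegLe-cong (λ x → cong (λ v → lookup v i) (f≗g x)) (f-small i)) ,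
  (λ e e<d g-small → f-not-smaller e e<d λ i → AnfDegLe-cong (λ x → cong (λ v → lookup v i) (sym (f≗g x))) (g-small i))

HasAlgDeg-left-inverse : ∀ {n} → InverseOfDegree n → (g : Vec Bool n → Vec Bool n) → (∀ x → g (κ x) ≡ x) →
                         HasAlgDeg g (dval n)
HasAlgDeg-left-inverse (B , inverse , degree) g g∘κ≗id =
  HasAlgDeg-cong (λ y → trans (sym (g∘κ≗id (applyPoly B y))) (cong g (proj₂ (inverse y)))) degree

oneXX-degree : HasDegree oneXX 2
oneXX-degree = refl , degBelow above
  where
  above : ∀ j → 3 ≤ j → coeff oneXX j ≡ false
  above (suc (suc (suc j))) _                = refl
  above 0                   ()
  above 1                   (s≤s ())
  above 2                   (s≤s (s≤s ()))

HasAlgDeg-κ : ∀ m → 4 ≤ suc m → HasAlgDeg (κ {suc m}) 3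
HasAlgDeg-κ 3 _ = HasAlgDeg-cong (sym ∘ κ≡applyPoly-oneXX)
  (HasAlgDeg-applyPoly-even 1 oneXX 0 (s≤s z≤n) refl (DegBelow-mono (n≤1+n 3) (proj₂ oneXX-degree)))
HasAlgDeg-κ (suc (suc (suc (suc m)))) _ = HasAlgDeg-cong (sym ∘ κ≡applyPoly-oneXX)
  (HasAlgDeg-applyPoly oneXX 2 oneXX-degree (s≤s (s≤s (s≤s (s≤s (s≤s z≤n))))))
HasAlgDeg-κ 0 (s≤s ())
HasAlgDeg-κ 1 (s≤s (s≤s ()))
HasAlgDeg-κ 2 (s≤s (s≤s (s≤s ())))

odd-half : ∀ n → n % 2 ≡ 1 → n ≡ suc (2 * (n / 2)) × (n + 1) / 2 ≡ suc (n / 2)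
odd-half n n-odd = n≡ , half (trans (cong (_+ 1) n≡) (arith (n / 2)))
  where
  n≡ : n ≡ suc (2 * (n / 2))
  n≡ = trans (m≡m%n+[m/n]*n n 2) (cong₂ _+_ n-odd (*-comm (n / 2) 2))
  arith : ∀ h → suc (2 * h) + 1 ≡ suc h * 2
  arith = solve-∀

P3-inverse-odd : ∀ n k → n % 2 ≡ 1 → (n + 1) / 2 ≤ 3 * k → InverseMod n (X^ ((n + 1) / 2)) (P3 k)
P3-inverse-odd n k n-odd = fit (proj₁ (odd-half n n-odd)) (proj₂ (odd-half n n-odd))
  where
  fit : ∀ {n' h'} → n' ≡ suc (2 * (n / 2)) → h' ≡ suc (n / 2) → h' ≤ 3 * k → InverseMod n' (X^ h') (P3 k)
  fit refl refl = P3-inverse (n / 2) k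

P3+X^-inverse-1mod6 : ∀ n k → (n + 1) / 2 ≤ 3 * k → (∀ j → (n + 1) / 2 ≤ 3 * j → k ≤ j) → n % 6 ≡ 1 →
                      InverseMod n (X^ ((n + 1) / 2)) (P3 k +P X^ (3 * k ∸ 2))
P3+X^-inverse-1mod6 n k h≤3k minimal n%6≡1 = fit n≡ h≡ k≡ (cong (_∸ 2) (trans (cong (3 *_) k≡) (*-suc 3 q)))
  where
  q = n / 6
  n≡ : n ≡ suc (2 * (3 * q))
  n≡ = trans (sym (6[n/6]+n%6≡n n)) (trans (cong (6 * q +_) n%6≡1) (arith₁ q))
    where
    arith₁ : ∀ q → 6 * q + 1 ≡ suc (2 * (3 * q))
    arith₁ = solve-∀
  h≡ : (n + 1) / 2 ≡ suc (3 * q)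
  h≡ = half (trans (cong (_+ 1) n≡) (arith₂ q))
    where
    arith₂ : ∀ q → suc (2 * (3 * q)) + 1 ≡ suc (3 * q) * 2
    arith₂ = solve-∀
  k≡ : k ≡ suc q
  k≡ = ≤-antisym (minimal (suc q) (subst (_≤ 3 * suc q) (sym h≡) 1+3q≤3[1+q]))
                 (*-cancelˡ-< 3 q k (subst (_≤ 3 * k) h≡ h≤3k))
    where
    1+3q≤3[1+q] : suc (3 * q) ≤ 3 * suc q
    1+3q≤3[1+q] = subst (suc (3 * q) ≤_) (sym (*-suc 3 q)) (≤-trans (n≤1+n _) (n≤1+n _))
  fit : ∀ {n' h' k' e} → n' ≡ suc (2 * (3 * q)) → h' ≡ suc (3 * q) → k' ≡ suc q → e ≡ suc (3 * q) →
        InverseMod n' (X^ h') (P3 k' +P X^ e)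
  fit refl refl refl refl = P3+X^-inverse q

theorem20 : (n : ℕ) → 4 ≤ n →
      (Bijective _≡_ _≡_ (κ {n}) ⇔ (¬ (6 ∣ n)))
    × HasAlgDeg (κ {n}) 3
    × (¬ (6 ∣ n) → (g : Vec Bool n → Vec Bool n) → (∀ x → g (κ x) ≡ x) → HasAlgDeg g (dval n))
    × ((k : ℕ) → n % 2 ≡ 1 → (n + 1) / 2 ≤ 3 * k → ((j : ℕ) → (n + 1) / 2 ≤ 3 * j → k ≤ j) →
          ((n % 6 ≡ 3 ⊎ n % 6 ≡ 5) →
              InvOfκ n (P3 k) × CongMod (X^ ((n + 1) / 2)) (oneXX *P P3 k) oneP)
        × (n % 6 ≡ 1 →
              InvOfκ n (P3 k +P X^ (3 * k ∸ 2))
            × CongMod (X^ ((n + 1) / 2)) (oneXX *P (P3 k +P X^ (3 * k ∸ 2))) oneP))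
    × ((k : ℕ) → n ≡ 6 * k + 2 →
          InvOfκ n (oneP +P ((Xp *P P3 k) +P (X^ 2 *P P3 (2 * k))))
        × CongMod (X^ n +P X^ (n / 2)) (oneXX *P (oneP +P ((Xp *P P3 k) +P (X^ 2 *P P3 (2 * k))))) oneP)
    × ((k : ℕ) → n ≡ 6 * k + 4 →
          InvOfκ n (oneP +P ((X^ 2 *P P3 k) +P (Xp *P P3 (2 * k + 1))))
        × CongMod (X^ n +P X^ (n / 2)) (oneXX *P (oneP +P ((X^ 2 *P P3 k) +P (Xp *P P3 (2 * k + 1))))) oneP)
theorem20 (suc m) 4≤n =
    mk⇔ (λ bijective 6∣n → κ-not-injective 6∣n (λ {x} {y} → proj₁ bijective {x} {y}))
        (λ 6∤n → let (B , inverse , _) = inverseOfDegree (suc m) 4≤n 6∤n in InvOfκ⇒Bijective B inverse)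
  , HasAlgDeg-κ m 4≤n
  , (λ 6∤n → HasAlgDeg-left-inverse (inverseOfDegree (suc m) 4≤n 6∤n))
  , (λ k n-odd h≤3k minimal → (λ _ → P3-inverse-odd (suc m) k n-odd h≤3k) , P3+X^-inverse-1mod6 (suc m) k h≤3k minimal)
  , B-6k+2-inverse (suc m)
  , B-6k+4-inverse (suc m)
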